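{- Let $G$ be a graph of order $n\geq 2$. (a) For every $k\geq 1$, $\gamma^r_k(G)=1$ if and only if $G\in\{P_2,P_3,\dots,P_{k+1}\}$. (b) Suppose $G$ is connected with $n\geq 4$. Then $\gamma^r_2(G)=n-2$ if and only if $G$ is $P_4$, or $K_{s,t}$ ($s,t\geq1$), or $K_s+\overline{K}_t$ ($s\geq 1,t\geq 2$), or $K_s+(K_1\cup K_t)$ ($s,t\geq 1$). For every $k\geq 3$, $\gamma^r_k(G)=n-2$ if and only if $G$ is $K_{s,t}$ ($s,t\geq1$), or $K_s+\overline{K}_t$ ($s\geq 1,t\geq 2$), or $K_s+(K_1\cup K_t)$ ($s,t\geq 1$). (c) Suppose $G$ is connected. For every $k\geq 2$, $\gamma^r_k(G)=n-1$ if and only if $G\cong K_n$.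
   Context: $P_m$ is the path on $m$ vertices, $K_m$ the complete graph, $K_{s,t}$ the complete bipartite graph, $\overline{H}$ the complement of $H$, $H_1\cup H_2$ the disjoint union, and $H_1+H_2$ the join (disjoint union plus all edges between $V(H_1)$ and $V(H_2)$). For a graph $G=(V,E)$ and $k\geq 1$, a set $D\subseteq V$ is distance $k$-dominating if every $v\in V\setminus D$ is at distance at most $k$ from some vertex of $D$. An ordered set $W=\{w_1,\dots,w_r\}$ is a resolving set if for all distinct $u,v\in V\setminus W$ the distance vectors $(d_G(u,w_i))_i$ and $(d_G(v,w_i))_i$ differ. $\gamma^r_k(G)$ is the minimum cardinality of a set that is both resolving and distance $k$-dominating. For disconnected graphs, the distance between vertices in different components is $\infty$. -}

module Defs where

open import Data.Nat using (ℕ; zero; suc; _+_; _≤_; ∣_-_∣) renaming (_≡ᵇ_ to _≡ℕᵇ_)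
open import Data.Bool using (Bool; true; false; _∧_; _∨_; not; if_then_else_)
open import Data.Fin using (Fin; toℕ; splitAt; _≟_)
open import Data.Fin.Subset using (Subset; _∈_; _∉_; ∣_∣)
open import Data.Maybe using (Maybe; just; nothing)
open import Data.Sum using (_⊎_; inj₁; inj₂)
open import Data.Product using (Σ; ∃; _×_; _,_)
open import Function.Definitions using (Bijective)
open import Relation.Binary.PropositionalEquality using (_≡_; _≢_)
open import Relation.Nullary.Decidable using (⌊_⌋)

Adj : ℕ → Set
Adj n = Fin n → Fin n → Bool

record Graph (n : ℕ) : Set where
  field
    adj    : Adj n
    sym    : ∀ u v → adj u v ≡ adj v u
    irrefl : ∀ v → adj v v ≡ false
open Graph public

anyFin : ∀ {n} → (Fin n → Bool) → Bool
anyFin {zero}  f = false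
anyFin {suc n} f = f Fin.zero ∨ anyFin (λ i → f (Fin.suc i))

reach : ∀ {n} → Adj n → ℕ → Fin n → Fin n → Bool
reach A zero    u v = ⌊ u ≟ v ⌋
reach A (suc m) u v = reach A m u v ∨ anyFin (λ w → reach A m u w ∧ A w v)

firstTrue : (ℕ → Bool) → ℕ → ℕ → Maybe ℕ
firstTrue p i zero       = nothing
firstTrue p i (suc fuel) = if p i then just i else firstTrue p (suc i) fuel

-- Graph distance; nothing encodes ∞ (different components).
-- In a graph of order n every finite distance is < n.
dist : ∀ {n} → Graph n → Fin n → Fin n → Maybe ℕ
dist {n} G u v = firstTrue (λ m → reach (adj G) m u v) 0 n

Connected : ∀ {n} → Graph n → Set
Connected G = ∀ u v → ∃ λ m → dist G u v ≡ just m

DistDominating : ∀ {n} → Graph n → ℕ → Subset n → Set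
DistDominating G k D =
  ∀ v → v ∉ D → ∃ λ u → u ∈ D × ∃ λ m → dist G u v ≡ just m × m ≤ k

-- W is a resolving set (distances compared in ℕ ∪ {∞})
Resolving : ∀ {n} → Graph n → Subset n → Set
Resolving G W =
  ∀ u v → u ≢ v → u ∉ W → v ∉ W → ∃ λ w → w ∈ W × dist G u w ≢ dist G v w

ResolvingDom : ∀ {n} → Graph n → ℕ → Subset n → Set
ResolvingDom G k D = Resolving G D × DistDominating G k D

GammaR : ∀ {n} → Graph n → ℕ → ℕ → Set
GammaR {n} G k r =
  (∃ λ (D : Subset n) → ResolvingDom G k D × ∣ D ∣ ≡ r)
  × (∀ (D : Subset n) → ResolvingDom G k D → r ≤ ∣ D ∣)

_≅_ : ∀ {n m} → Graph n → Adj m → Set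
_≅_ {n} {m} G H = Σ (Fin n → Fin m) λ f →
  Bijective _≡_ _≡_ f × (∀ u v → adj G u v ≡ H (f u) (f v))

pathG : ∀ m → Adj m
pathG m i j = ∣ toℕ i - toℕ j ∣ ≡ℕᵇ 1

complete : ∀ m → Adj m
complete m i j = not ⌊ i ≟ j ⌋

emptyG : ∀ m → Adj m
emptyG m i j = false

_∪G_ : ∀ {a b} → Adj a → Adj b → Adj (a + b)
_∪G_ {a} H₁ H₂ i j with splitAt a i | splitAt a j
... | inj₁ x | inj₁ y = H₁ x y
... | inj₂ x | inj₂ y = H₂ x y
... | inj₁ _ | inj₂ _ = false
... | inj₂ _ | inj₁ _ = false

_+G_ : ∀ {a b} → Adj a → Adj b → Adj (a + b)
_+G_ {a} H₁ H₂ i j with splitAt a i | splitAt a j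
... | inj₁ x | inj₁ y = H₁ x y
... | inj₂ x | inj₂ y = H₂ x y
... | inj₁ _ | inj₂ _ = true
... | inj₂ _ | inj₁ _ = true

completeBip : ∀ s t → Adj (s + t)
completeBip s t = emptyG s +G emptyG t

-- Distances to a single landmark w are injective and bounded by k, so they enumerate
-- 0, …, n − 1, and two vertices are adjacent exactly when their levels differ by one: G is a
-- path with w at an end.  For the value n − 2, a geodesic u₀u₁u₂u₃ makes V ∖ {u₀, u₁, u₂}
-- resolving; this set is k-dominating when k ≥ 3, and for k = 2 it fails only for G = P₄.
-- In diameter two distances are read off adjacency, so V ∖ {a, b, c} resolves precisely when
-- each pair among a, b, c is separated by another vertex, and γ = n − 2 exactly when G is not
-- complete and has no such separated triple.  Without an induced K₁ ∪ K₂, non-adjacency is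
-- transitive, G is complete multipartite, and this leaves K_{s,t} and K_s + K̄_t.  With one, the
-- graph is forced to be K_s + (K₁ ∪ K_t) by five small configurations, each of which contains a
-- separated triple, as checked by enumerating all graphs on five or six vertices.  Finally, in
-- K_n two vertices outside a resolving set are twins, whereas a connected non-complete graph
-- has an induced P₃ u w v, and V ∖ {u, w} is resolving and 2-dominating.

module Submission where

open import Defs hiding (sym)
open import Data.Nat using (ℕ; zero; suc; _+_; _∸_; _≤_; _<_; z≤n; s≤s; _≤?_; ∣_-_∣; _≡ᵇ_)
open import Data.Nat.Properties using (≤-refl; ≤-trans; ≤-antisym; ≤-pred; <-irrefl; <-cmp; ≤-<-trans; <-≤-trans; <⇒≤; ≤-reflexive; ≮⇒≥; m≤n⇒m≤1+n; +-suc; +-comm; +-identityʳ; m≤m+n; ≰⇒>; +-mono-≤; ∣n-n∣≡0; ∣-∣-triangle; ∣-∣-identityʳ; ≡ᵇ⇒≡; m+n≤o⇒m≤o∸n; m+[n∸m]≡n; suc-injective; module ≤-Reasoning)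
open import Data.Bool using (Bool; true; false; _∧_; _∨_; not; if_then_else_; _xor_; T)
open import Data.Bool.Properties using () renaming (_≟_ to _≟ᵇ_)
open import Data.Fin using (Fin; zero; suc; _≟_; toℕ; fromℕ; fromℕ<; splitAt; join; _↑ˡ_; _↑ʳ_; punchOut; #_)
open import Data.Fin.Properties using (any?; ↑ˡ-injective; ↑ʳ-injective; splitAt-join; join-splitAt; splitAt-↑ˡ; splitAt-↑ʳ; punchOut-injective; injective⇒≤; toℕ-fromℕ<; toℕ-fromℕ; toℕ-injective; toℕ<n)
open import Data.Fin.Subset using () renaming (_-_ to _∖_)
open import Data.Fin.Subset using (Subset; _∈_; _∉_; ∣_∣; ⊤; ⁅_⁆; _─_; ∁; inside; outside; Nonempty)
open import Data.Fin.Subset.Properties using (∈⊤; x∈p∧x≢y⇒x∈p-y; ∣⊤∣≡n; ∣∁p∣≡n∸∣p∣; x∈⁅x⁆; ∣⁅x⁆∣≡1; x∈∁p⇒x∉p; _∈?_; p─⊥≡p; p─q⊆p)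
open import Data.Maybe using (just)
open import Data.Maybe.Properties using (just-injective)
open import Data.Sum using (_⊎_; inj₁; inj₂; [_,_]′; map; map₁; map₂)
open import Data.Sum.Properties using (inj₁-injective; inj₂-injective)
open import Data.Product using (Σ; ∃; ∃₂; _×_; _,_; proj₁; proj₂)
open import Data.Unit using (tt) renaming (⊤ to Unit)
open import Data.Empty using (⊥; ⊥-elim)
open import Data.List using (List; []; _∷_)
open import Data.List.Relation.Unary.All using (All; []; _∷_)
open import Data.Vec using (Vec; []; _∷_; lookup; tabulate; here; there)
open import Data.Vec.Properties using (lookup∘tabulate)
open import Data.Vec.Relation.Unary.Unique.Propositional using (Unique)
open import Data.Vec.Relation.Unary.AllPairs using ([]; _∷_)
open import Data.Vec.Relation.Unary.All using ([]; _∷_)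
open import Data.Vec.Relation.Unary.Unique.Propositional.Properties using (lookup-injective)
open import Function using (_∘_; id)
open import Function.Bundles using (_⇔_; mk⇔)
open import Function.Definitions using (Injective)
open import Relation.Binary.PropositionalEquality using (_≡_; _≢_; refl; sym; trans; cong; cong₂; subst; module ≡-Reasoning)
open import Relation.Nullary using (¬_; yes; no; Dec)
open import Relation.Binary using (tri<; tri≈; tri>)
open import Relation.Nullary.Decidable using (⌊_⌋; _×-dec_; ¬?)

-- Walks and distances

true≢false : true ≢ false
true≢false ()

≢true⇒≡false : ∀ {b} → b ≢ true → b ≡ false
≢true⇒≡false {true}  h = ⊥-elim (h refl)
≢true⇒≡false {false} _ = refl

≢false⇒≡true : ∀ {b} → b ≢ false → b ≡ true
≢false⇒≡true {true}  _ = refl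
≢false⇒≡true {false} h = ⊥-elim (h refl)

not≡true⇒≡false : ∀ {b} → not b ≡ true → b ≡ false
not≡true⇒≡false {false} _ = refl

not≡false⇒≡true : ∀ {b} → not b ≡ false → b ≡ true
not≡false⇒≡true {true} _ = refl

∨-introˡ : ∀ {a} b → a ≡ true → a ∨ b ≡ true
∨-introˡ b refl = refl

∨-introʳ : ∀ a {b} → b ≡ true → a ∨ b ≡ true
∨-introʳ true  _ = refl
∨-introʳ false e = e

∨-elim : ∀ a {b} → a ∨ b ≡ true → a ≡ true ⊎ b ≡ true
∨-elim true  _ = inj₁ refl
∨-elim false e = inj₂ e

∧-intro : ∀ {a b} → a ≡ true → b ≡ true → a ∧ b ≡ true
∧-intro refl refl = refl

∧-elim : ∀ a {b} → a ∧ b ≡ true → a ≡ true × b ≡ true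
∧-elim true e = refl , e

⌊⌋-true : ∀ {A : Set} (a? : Dec A) → A → ⌊ a? ⌋ ≡ true
⌊⌋-true (yes _) _ = refl
⌊⌋-true (no ¬a) a = ⊥-elim (¬a a)

⌊⌋-false : ∀ {A : Set} (a? : Dec A) → ¬ A → ⌊ a? ⌋ ≡ false
⌊⌋-false (yes a) ¬a = ⊥-elim (¬a a)
⌊⌋-false (no _) _ = refl

⌊⌋≡true⇒ : ∀ {A : Set} (a? : Dec A) → ⌊ a? ⌋ ≡ true → A
⌊⌋≡true⇒ (yes a) _ = a

⌊⌋≡false⇒¬ : ∀ {A : Set} (a? : Dec A) → ⌊ a? ⌋ ≡ false → ¬ A
⌊⌋≡false⇒¬ (no ¬a) _ = ¬a

anyFin-intro : ∀ {n} (f : Fin n → Bool) i → f i ≡ true → anyFin f ≡ true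
anyFin-intro f zero    e = ∨-introˡ _ e
anyFin-intro f (suc i) e = ∨-introʳ (f zero) (anyFin-intro (f ∘ suc) i e)

anyFin-elim : ∀ {n} (f : Fin n → Bool) → anyFin f ≡ true → ∃ λ i → f i ≡ true
anyFin-elim {suc n} f e with ∨-elim (f zero) e
... | inj₁ e₀ = zero , e₀
... | inj₂ e₁ with anyFin-elim (f ∘ suc) e₁
...   | i , eᵢ = suc i , eᵢ

module _ {n : ℕ} (A : Adj n) where

  reach-refl : ∀ u → reach A 0 u u ≡ true
  reach-refl u = ⌊⌋-true (u ≟ u) refl

  reach₀⇒≡ : ∀ {u v} → reach A 0 u v ≡ true → u ≡ v
  reach₀⇒≡ {u} {v} = ⌊⌋≡true⇒ (u ≟ v)

  reach-weaken : ∀ m {u v} → reach A m u v ≡ true → reach A (suc m) u v ≡ true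
  reach-weaken m = ∨-introˡ _

  reach-snoc : ∀ m {u w v} → reach A m u w ≡ true → A w v ≡ true → reach A (suc m) u v ≡ true
  reach-snoc m {u} {w} r a = ∨-introʳ (reach A m u _) (anyFin-intro _ w (∧-intro r a))

  reach-suc⁻ : ∀ m {u v} → reach A (suc m) u v ≡ true →
               reach A m u v ≡ true ⊎ ∃ λ w → reach A m u w ≡ true × A w v ≡ true
  reach-suc⁻ m {u} {v} e with ∨-elim (reach A m u v) e
  ... | inj₁ r = inj₁ r
  ... | inj₂ r with anyFin-elim _ r
  ...   | w , rw = inj₂ (w , ∧-elim (reach A m u w) rw)

  reach-mono : ∀ {m m′ u v} → m ≤ m′ → reach A m u v ≡ true → reach A m′ u v ≡ true
  reach-mono {zero}  {zero}   _ r = r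
  reach-mono {zero}  {suc m′} _ r = reach-weaken m′ (reach-mono {zero} {m′} z≤n r)
  reach-mono {suc m} {suc m′} (s≤s m≤m′) r with reach-suc⁻ m r
  ... | inj₁ r₁ = reach-weaken m′ (reach-mono m≤m′ r₁)
  ... | inj₂ (w , rw , a) = reach-snoc m′ (reach-mono m≤m′ rw) a

  reach-cons : ∀ m {w u v} → A w u ≡ true → reach A m u v ≡ true → reach A (suc m) w v ≡ true
  reach-cons zero    {w} a r rewrite reach₀⇒≡ r = reach-snoc 0 (reach-refl w) a
  reach-cons (suc m) a r with reach-suc⁻ m r
  ... | inj₁ r₁ = reach-weaken (suc m) (reach-cons m a r₁)
  ... | inj₂ (c , rc , ac) = reach-snoc (suc m) (reach-cons m a rc) ac

  module _ (A-sym : ∀ u v → A u v ≡ A v u) where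

    reach-sym : ∀ m {u v} → reach A m u v ≡ true → reach A m v u ≡ true
    reach-sym zero    r rewrite reach₀⇒≡ r = reach-refl _
    reach-sym (suc m) r with reach-suc⁻ m r
    ... | inj₁ r₁ = reach-weaken m (reach-sym m r₁)
    ... | inj₂ (c , rc , ac) = reach-cons m (trans (A-sym _ _) ac) (reach-sym m rc)

    reach-comm : ∀ m u v → reach A m u v ≡ reach A m v u
    reach-comm m u v with reach A m u v in e₁ | reach A m v u in e₂
    ... | true  | true  = refl
    ... | false | false = refl
    ... | true  | false = ⊥-elim (true≢false (trans (sym (reach-sym m e₁)) e₂))
    ... | false | true  = ⊥-elim (true≢false (trans (sym (reach-sym m e₂)) e₁))

firstTrue-sound : ∀ p i f {m} → firstTrue p i f ≡ just m →
                  p m ≡ true × i ≤ m × m < i + f × (∀ j → i ≤ j → j < m → p j ≡ false)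
firstTrue-sound p i (suc f) {m} e with p i in pᵢ
firstTrue-sound p i (suc f) refl | true =
  pᵢ , ≤-refl , subst (i <_) (sym (+-suc i f)) (s≤s (m≤m+n i f)) ,
  λ j i≤j j<i → ⊥-elim (<-irrefl refl (≤-<-trans i≤j j<i))
firstTrue-sound p i (suc f) {m} e | false with firstTrue-sound p (suc i) f e
... | pₘ , i<m , m<i+f , below = pₘ , <⇒≤ i<m , subst (m <_) (sym (+-suc i f)) m<i+f , below′
  where
  below′ : ∀ j → i ≤ j → j < m → p j ≡ false
  below′ j i≤j j<m with <-cmp i j
  ... | tri< i<j _ _ = below j i<j j<m
  ... | tri≈ _ refl _ = pᵢ
  ... | tri> _ _ j<i = ⊥-elim (<-irrefl refl (≤-<-trans i≤j j<i))

firstTrue-complete : ∀ p i f {m} → p m ≡ true → i ≤ m → m < i + f → ∃ λ m′ → firstTrue p i f ≡ just m′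
firstTrue-complete p i zero    _ i≤m m<i rewrite +-identityʳ i = ⊥-elim (<-irrefl refl (≤-<-trans i≤m m<i))
firstTrue-complete p i (suc f) {m} pₘ i≤m m<i+f with p i in pᵢ
... | true = i , refl
... | false with <-cmp i m
...   | tri< i<m _ _ = firstTrue-complete p (suc i) f pₘ i<m (subst (m <_) (+-suc i f) m<i+f)
...   | tri≈ _ refl _ = ⊥-elim (true≢false (trans (sym pₘ) pᵢ))
...   | tri> _ _ m<i = ⊥-elim (<-irrefl refl (≤-<-trans i≤m m<i))

firstTrue-cong : ∀ p q i f → (∀ j → p j ≡ q j) → firstTrue p i f ≡ firstTrue q i f
firstTrue-cong p q i zero    _ = refl
firstTrue-cong p q i (suc f) p≗q rewrite p≗q i with q i
... | true  = refl
... | false = firstTrue-cong p q (suc i) f p≗q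

another : ∀ {n} → 2 ≤ n → (u : Fin n) → ∃ λ v → u ≢ v
another (s≤s (s≤s _)) zero    = suc zero , λ ()
another (s≤s (s≤s _)) (suc u) = zero , λ ()

fin⇒1≤ : ∀ {n} → Fin n → 1 ≤ n
fin⇒1≤ {suc n} _ = s≤s z≤n

≢⇒2≤ : ∀ {n} {u v : Fin n} → u ≢ v → 2 ≤ n
≢⇒2≤ {u = u} {v} u≢v = injective⇒≤ {f = lookup (u ∷ v ∷ [])} (lookup-injective ((u≢v ∷ []) ∷ [] ∷ []) _ _)

≢⇒3≤ : ∀ {n} {a b c : Fin n} → a ≢ b → a ≢ c → b ≢ c → 3 ≤ n
≢⇒3≤ {a = a} {b} {c} a≢b a≢c b≢c =
  injective⇒≤ {f = lookup (a ∷ b ∷ c ∷ [])} (lookup-injective ((a≢b ∷ a≢c ∷ []) ∷ (b≢c ∷ []) ∷ [] ∷ []) _ _)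

module _ {n : ℕ} (G : Graph n) where

  adj-sym : ∀ u v → adj G u v ≡ adj G v u
  adj-sym = Graph.sym G

  adj-flip : ∀ {u v b} → adj G u v ≡ b → adj G v u ≡ b
  adj-flip = trans (adj-sym _ _)

  adj⇒≢ : ∀ {u v} → adj G u v ≡ true → u ≢ v
  adj⇒≢ a refl = true≢false (trans (sym a) (irrefl G _))

  adj≢nonadj : ∀ {a u v} → adj G a u ≡ true → adj G a v ≡ false → u ≢ v
  adj≢nonadj a na refl = true≢false (trans (sym a) na)

  nonadj≢adj : ∀ {a u v} → adj G a u ≡ false → adj G a v ≡ true → u ≢ v
  nonadj≢adj na a = adj≢nonadj a na ∘ sym

  dist⇒reach : ∀ {u v m} → dist G u v ≡ just m → reach (adj G) m u v ≡ true
  dist⇒reach e = proj₁ (firstTrue-sound _ 0 n e)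

  dist-minimal : ∀ {u v m} → dist G u v ≡ just m → ∀ j → j < m → reach (adj G) j u v ≡ false
  dist-minimal e j j<m = proj₂ (proj₂ (proj₂ (firstTrue-sound _ 0 n e))) j z≤n j<m

  dist<n : ∀ {u v m} → dist G u v ≡ just m → m < n
  dist<n e = proj₁ (proj₂ (proj₂ (firstTrue-sound _ 0 n e)))

  reach⇒dist≤ : ∀ {u v m} → reach (adj G) m u v ≡ true → m < n → ∃ λ m′ → m′ ≤ m × dist G u v ≡ just m′
  reach⇒dist≤ {u} {v} {m} r m<n with firstTrue-complete (λ j → reach (adj G) j u v) 0 n r z≤n m<n
  ... | m′ , e with <-cmp m m′
  ...   | tri< m<m′ _ _ = ⊥-elim (true≢false (trans (sym r) (dist-minimal e m m<m′)))
  ...   | tri≈ _ refl _ = m′ , ≤-refl , e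
  ...   | tri> _ _ m′<m = m′ , <⇒≤ m′<m , e

  reach⇒dist≡ : ∀ {u v m} → reach (adj G) m u v ≡ true → (∀ j → j < m → reach (adj G) j u v ≡ false) →
                m < n → dist G u v ≡ just m
  reach⇒dist≡ {m = m} r below m<n with reach⇒dist≤ r m<n
  ... | m′ , m′≤m , e with <-cmp m′ m
  ...   | tri< m′<m _ _ = ⊥-elim (true≢false (trans (sym (dist⇒reach e)) (below m′ m′<m)))
  ...   | tri≈ _ refl _ = e
  ...   | tri> _ _ m<m′ = ⊥-elim (<-irrefl refl (<-≤-trans m<m′ m′≤m))

  dist-sym : ∀ u v → dist G u v ≡ dist G v u
  dist-sym u v = firstTrue-cong _ _ 0 n (λ j → reach-comm (adj G) adj-sym j u v)

  dist≡0⇒≡ : ∀ {u v} → dist G u v ≡ just 0 → u ≡ v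
  dist≡0⇒≡ e = reach₀⇒≡ (adj G) (dist⇒reach e)

  dist-refl : ∀ u → dist G u u ≡ just 0
  dist-refl u = reach⇒dist≡ (reach-refl (adj G) u) (λ _ ()) (fin⇒1≤ u)

  reach₀-false : ∀ {u v} → u ≢ v → reach (adj G) 0 u v ≡ false
  reach₀-false u≢v = ≢true⇒≡false (u≢v ∘ reach₀⇒≡ (adj G))

  reach₁⁻ : ∀ {u v} → reach (adj G) 1 u v ≡ true → u ≡ v ⊎ adj G u v ≡ true
  reach₁⁻ r with reach-suc⁻ (adj G) 0 r
  ... | inj₁ r₀ = inj₁ (reach₀⇒≡ (adj G) r₀)
  ... | inj₂ (w , r₀ , a) rewrite reach₀⇒≡ (adj G) r₀ = inj₂ a

  reach₂⁻ : ∀ {u v} → reach (adj G) 2 u v ≡ true →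
            u ≡ v ⊎ adj G u v ≡ true ⊎ ∃ λ c → adj G u c ≡ true × adj G c v ≡ true
  reach₂⁻ r with reach-suc⁻ (adj G) 1 r
  ... | inj₁ r₁ = map₂ inj₁ (reach₁⁻ r₁)
  ... | inj₂ (w , r₁ , a) with reach₁⁻ r₁
  ...   | inj₁ refl = inj₂ (inj₁ a)
  ...   | inj₂ a′ = inj₂ (inj₂ (w , a′ , a))

  reach₁ : ∀ {u v} → adj G u v ≡ true → reach (adj G) 1 u v ≡ true
  reach₁ = reach-snoc (adj G) 0 (reach-refl (adj G) _)

  reach₂ : ∀ {u c v} → adj G u c ≡ true → adj G c v ≡ true → reach (adj G) 2 u v ≡ true
  reach₂ a b = reach-snoc (adj G) 1 (reach₁ a) b

  reach₁-false : ∀ {u v} → u ≢ v → adj G u v ≡ false → reach (adj G) 1 u v ≡ false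
  reach₁-false u≢v na = ≢true⇒≡false λ r → [ u≢v , (λ a → true≢false (trans (sym a) na)) ]′ (reach₁⁻ r)

  adj⇒dist≡1 : ∀ {u v} → adj G u v ≡ true → dist G u v ≡ just 1
  adj⇒dist≡1 a = reach⇒dist≡ (reach₁ a) (λ { zero _ → reach₀-false (adj⇒≢ a) ; (suc _) (s≤s ()) }) (≢⇒2≤ (adj⇒≢ a))

  dist≡1⇒adj : ∀ {u v} → dist G u v ≡ just 1 → adj G u v ≡ true
  dist≡1⇒adj e with reach₁⁻ (dist⇒reach e)
  ... | inj₂ a = a
  ... | inj₁ refl = ⊥-elim (true≢false (trans (sym (reach-refl (adj G) _)) (dist-minimal e 0 (s≤s z≤n))))

  dist≡2 : ∀ {u c v} → u ≢ v → adj G u v ≡ false → adj G u c ≡ true → adj G c v ≡ true → 2 < n →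
           dist G u v ≡ just 2
  dist≡2 u≢v na a b 2<n =
    reach⇒dist≡ (reach₂ a b) (λ { zero _ → reach₀-false u≢v ; (suc zero) _ → reach₁-false u≢v na
                                ; (suc (suc _)) (s≤s (s≤s ())) }) 2<n

  dist-first-step : ∀ {u v m} → dist G v u ≡ just (suc m) →
                    ∃ λ w → adj G u w ≡ true × reach (adj G) m v w ≡ true
  dist-first-step {u} {m = m} e with reach-suc⁻ (adj G) m (dist⇒reach e)
  ... | inj₁ r = ⊥-elim (true≢false (trans (sym r) (dist-minimal e m ≤-refl)))
  ... | inj₂ (w , r , a) = w , adj-flip a , r

module _ {n : ℕ} (G : Graph n) where

  record GeodesicP4 : Set where
    field
      u₀ u₁ u₂ u₃ : Fin n
      a₀₁ : adj G u₀ u₁ ≡ true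
      a₁₂ : adj G u₁ u₂ ≡ true
      a₂₃ : adj G u₂ u₃ ≡ true
      n₀₂ : adj G u₀ u₂ ≡ false
      n₁₃ : adj G u₁ u₃ ≡ false
      n₀₃ : adj G u₀ u₃ ≡ false
      d₀₂ : u₀ ≢ u₂
      d₁₃ : u₁ ≢ u₃
      d₀₃ : u₀ ≢ u₃
      no-common : ∀ c → adj G u₀ c ≡ true → adj G c u₃ ≡ true → ⊥

  reverseP4 : GeodesicP4 → GeodesicP4
  reverseP4 p = record
    { u₀ = u₃ ; u₁ = u₂ ; u₂ = u₁ ; u₃ = u₀
    ; a₀₁ = adj-flip G a₂₃ ; a₁₂ = adj-flip G a₁₂ ; a₂₃ = adj-flip G a₀₁
    ; n₀₂ = adj-flip G n₁₃ ; n₁₃ = adj-flip G n₀₂ ; n₀₃ = adj-flip G n₀₃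
    ; d₀₂ = d₁₃ ∘ sym ; d₁₃ = d₀₂ ∘ sym ; d₀₃ = d₀₃ ∘ sym
    ; no-common = λ c a b → no-common c (adj-flip G b) (adj-flip G a) }
    where
    open GeodesicP4 p

  vertices : GeodesicP4 → Vec (Fin n) 4
  vertices P = u₀ ∷ u₁ ∷ u₂ ∷ u₃ ∷ []
    where open GeodesicP4 P

  vertices-unique : ∀ P → Unique (vertices P)
  vertices-unique P =
    (adj⇒≢ G a₀₁ ∷ d₀₂ ∷ d₀₃ ∷ []) ∷ (adj⇒≢ G a₁₂ ∷ d₁₃ ∷ []) ∷ (adj⇒≢ G a₂₃ ∷ []) ∷ [] ∷ []
    where open GeodesicP4 P

  vertices-induce-P₄ : ∀ P i j → adj G (lookup (vertices P) i) (lookup (vertices P) j) ≡ pathG 4 i j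
  vertices-induce-P₄ P = table
    where
    open GeodesicP4 P
    table : ∀ i j → adj G (lookup (vertices P) i) (lookup (vertices P) j) ≡ pathG 4 i j
    table zero                   zero                   = irrefl G u₀
    table zero                   (suc zero)             = a₀₁
    table zero                   (suc (suc zero))       = n₀₂
    table zero                   (suc (suc (suc zero))) = n₀₃
    table (suc zero)             zero                   = adj-flip G a₀₁
    table (suc zero)             (suc zero)             = irrefl G u₁
    table (suc zero)             (suc (suc zero))       = a₁₂
    table (suc zero)             (suc (suc (suc zero))) = n₁₃
    table (suc (suc zero))       zero                   = adj-flip G n₀₂
    table (suc (suc zero))       (suc zero)             = adj-flip G a₁₂
    table (suc (suc zero))       (suc (suc zero))       = irrefl G u₂
    table (suc (suc zero))       (suc (suc (suc zero))) = a₂₃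
    table (suc (suc (suc zero))) zero                   = adj-flip G n₀₃
    table (suc (suc (suc zero))) (suc zero)             = adj-flip G n₁₃
    table (suc (suc (suc zero))) (suc (suc zero))       = adj-flip G a₂₃
    table (suc (suc (suc zero))) (suc (suc (suc zero))) = irrefl G u₃

  -- The last four vertices of a shortest a–b walk.
  far-pair⇒geodesicP4 : Connected G → ∀ a b → reach (adj G) 2 a b ≢ true → GeodesicP4
  far-pair⇒geodesicP4 con a b ¬r₂ = go (proj₁ (con a b)) (proj₂ (con a b))
    where
    go : ∀ m → dist G a b ≡ just m → GeodesicP4
    go zero                e = ⊥-elim (¬r₂ (reach-mono (adj G) {0} {2} z≤n (dist⇒reach G e)))
    go (suc zero)          e = ⊥-elim (¬r₂ (reach-mono (adj G) {1} {2} (s≤s z≤n) (dist⇒reach G e)))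
    go (suc (suc zero))    e = ⊥-elim (¬r₂ (dist⇒reach G e))
    go (suc (suc (suc m))) e = p4 (reach-suc⁻ R (suc (suc m)) (dist⇒reach G e))
      where
      R : Adj n
      R = adj G
      short : ∀ {j} → j ≤ suc (suc m) → reach R j a b ≢ true
      short j≤ r = true≢false (trans (sym (reach-mono R j≤ r)) (dist-minimal G e _ ≤-refl))
      short₁ : suc m ≤ suc (suc m)
      short₁ = m≤n⇒m≤1+n ≤-refl
      short₂ : m ≤ suc (suc m)
      short₂ = m≤n⇒m≤1+n (m≤n⇒m≤1+n ≤-refl)
      p4 : reach R (suc (suc m)) a b ≡ true ⊎ (∃ λ w → reach R (suc (suc m)) a w ≡ true × R w b ≡ true) → GeodesicP4
      p4 (inj₁ r) = ⊥-elim (short ≤-refl r)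
      p4 (inj₂ (v₁ , r₁ , a₁)) with reach-suc⁻ R (suc m) r₁
      ... | inj₁ r = ⊥-elim (short ≤-refl (reach-snoc R (suc m) r a₁))
      ... | inj₂ (v₂ , r₂ , a₂) with reach-suc⁻ R m r₂
      ...   | inj₁ r = ⊥-elim (short ≤-refl (reach-snoc R (suc m) (reach-snoc R m r a₂) a₁))
      ...   | inj₂ (v₃ , r₃ , a₃) = record
        { u₀ = v₃ ; u₁ = v₂ ; u₂ = v₁ ; u₃ = b
        ; a₀₁ = a₃ ; a₁₂ = a₂ ; a₂₃ = a₁
        ; n₀₂ = ≢true⇒≡false λ x → short ≤-refl (reach-snoc R (suc m) (reach-snoc R m r₃ x) a₁)
        ; n₁₃ = ≢true⇒≡false λ x → short ≤-refl (reach-snoc R (suc m) r₂ x)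
        ; n₀₃ = ≢true⇒≡false λ x → short short₁ (reach-snoc R m r₃ x)
        ; d₀₂ = λ { refl → short ≤-refl (reach-snoc R (suc m) (reach-weaken R m r₃) a₁) }
        ; d₁₃ = λ { refl → short short₁ r₂ }
        ; d₀₃ = λ { refl → short short₂ r₃ }
        ; no-common = λ c x y → short ≤-refl (reach-snoc R (suc m) (reach-snoc R m r₃ x) y) }

  nonadjacent⇒inducedP3 : Connected G → ∀ a b → a ≢ b → adj G a b ≡ false →
    ∃₂ λ u w → ∃ λ v → adj G u w ≡ true × adj G w v ≡ true × adj G u v ≡ false × u ≢ v
  nonadjacent⇒inducedP3 con a b a≢b na with con a b
  ... | zero , e = ⊥-elim (a≢b (dist≡0⇒≡ G e))
  ... | suc zero , e = ⊥-elim (true≢false (trans (sym (dist≡1⇒adj G e)) na))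
  ... | suc (suc m) , e = p3 (reach-suc⁻ (adj G) (suc m) (dist⇒reach G e))
    where
    short : reach (adj G) (suc m) a b ≢ true
    short r = true≢false (trans (sym r) (dist-minimal G e (suc m) ≤-refl))
    p3 : reach (adj G) (suc m) a b ≡ true ⊎ (∃ λ w → reach (adj G) (suc m) a w ≡ true × adj G w b ≡ true) →
         ∃₂ λ u w → ∃ λ v → adj G u w ≡ true × adj G w v ≡ true × adj G u v ≡ false × u ≢ v
    p3 (inj₁ r) = ⊥-elim (short r)
    p3 (inj₂ (v₁ , r₁ , a₁)) with reach-suc⁻ (adj G) m r₁
    ... | inj₁ r = ⊥-elim (short (reach-snoc (adj G) m r a₁))
    ... | inj₂ (v₂ , r₂ , a₂) =
      v₂ , v₁ , b , a₂ , a₁ , ≢true⇒≡false (λ x → short (reach-snoc (adj G) m r₂ x)) ,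
      λ { refl → short (reach-weaken (adj G) m r₂) }

-- Sets of vertices

x∈p─q⇒x∉q : ∀ {n} {x : Fin n} {p q : Subset n} → x ∈ p ─ q → x ∉ q
x∈p─q⇒x∉q {p = _ ∷ p} {outside ∷ q} (there x∈) (there x∈q) = x∈p─q⇒x∉q x∈ x∈q
x∈p─q⇒x∉q {p = _ ∷ p} {inside  ∷ q} (there x∈) (there x∈q) = x∈p─q⇒x∉q x∈ x∈q

∣p∖x∣ : ∀ {n} {x : Fin n} {p : Subset n} → x ∈ p → suc ∣ p ∖ x ∣ ≡ ∣ p ∣
∣p∖x∣ {p = inside ∷ p} here = cong (suc ∘ ∣_∣) (p─⊥≡p p)
∣p∖x∣ {p = inside  ∷ p} (there x∈p) = cong suc (∣p∖x∣ x∈p)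
∣p∖x∣ {p = outside ∷ p} (there x∈p) = ∣p∖x∣ x∈p

x∈p⇒1≤∣p∣ : ∀ {n} {x : Fin n} {p : Subset n} → x ∈ p → 1 ≤ ∣ p ∣
x∈p⇒1≤∣p∣ x∈p = subst (1 ≤_) (∣p∖x∣ x∈p) (s≤s z≤n)

1≤∣p∣⇒Nonempty : ∀ {n} {p : Subset n} → 1 ≤ ∣ p ∣ → Nonempty p
1≤∣p∣⇒Nonempty {p = inside  ∷ p} _ = zero , here
1≤∣p∣⇒Nonempty {p = outside ∷ p} 1≤ with 1≤∣p∣⇒Nonempty {p = p} 1≤
... | x , x∈p = suc x , there x∈p

x∈p∖y⇒x≢y : ∀ {n} {x y : Fin n} {p : Subset n} → x ∈ p ∖ y → x ≢ y
x∈p∖y⇒x≢y {y = y} x∈ refl = x∈p─q⇒x∉q x∈ (x∈⁅x⁆ y)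

x∈p∖y⇒x∈p : ∀ {n} {x y : Fin n} {p : Subset n} → x ∈ p ∖ y → x ∈ p
x∈p∖y⇒x∈p {y = y} {p} = p─q⊆p p ⁅ y ⁆

x∈p∧x∉p∖y⇒x≡y : ∀ {n} {x y : Fin n} {p : Subset n} → x ∈ p → x ∉ p ∖ y → x ≡ y
x∈p∧x∉p∖y⇒x≡y {x = x} {y} x∈p x∉ with x ≟ y
... | yes x≡y = x≡y
... | no x≢y = ⊥-elim (x∉ (x∈p∧x≢y⇒x∈p-y x∈p x≢y))

∣p∣≡1⇒singleton : ∀ {n} {p : Subset n} → ∣ p ∣ ≡ 1 → ∃ λ w → w ∈ p × ∀ v → v ∈ p → v ≡ w
∣p∣≡1⇒singleton {p = p} ∣p∣≡1 with 1≤∣p∣⇒Nonempty (subst (1 ≤_) (sym ∣p∣≡1) ≤-refl)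
... | w , w∈p = w , w∈p , λ v v∈p → x∈p∧x∉p∖y⇒x≡y v∈p (empty v)
  where
  ∣p∖w∣≡0 : ∣ p ∖ w ∣ ≡ 0
  ∣p∖w∣≡0 = suc-injective (trans (∣p∖x∣ w∈p) ∣p∣≡1)
  empty : ∀ v → v ∉ p ∖ w
  empty v v∈ with subst (1 ≤_) ∣p∖w∣≡0 (x∈p⇒1≤∣p∣ v∈)
  ... | ()

two-elements : ∀ {n} {p : Subset n} → 2 ≤ ∣ p ∣ → ∃₂ λ u v → u ≢ v × u ∈ p × v ∈ p
two-elements {p = p} 2≤ with 1≤∣p∣⇒Nonempty {p = p} (≤-trans (s≤s z≤n) 2≤)
... | u , u∈ with 1≤∣p∣⇒Nonempty {p = p ∖ u} (≤-pred (subst (2 ≤_) (sym (∣p∖x∣ u∈)) 2≤))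
...   | v , v∈ = u , v , (λ u≡v → x∈p∖y⇒x≢y v∈ (sym u≡v)) , u∈ , x∈p∖y⇒x∈p v∈

three-elements : ∀ {n} {p : Subset n} → 3 ≤ ∣ p ∣ →
                 ∃₂ λ u v → ∃ λ w → u ≢ v × u ≢ w × v ≢ w × u ∈ p × v ∈ p × w ∈ p
three-elements {p = p} 3≤ with 1≤∣p∣⇒Nonempty {p = p} (≤-trans (s≤s z≤n) 3≤)
... | u , u∈ with two-elements {p = p ∖ u} (≤-pred (subst (3 ≤_) (sym (∣p∖x∣ u∈)) 3≤))
...   | v , w , v≢w , v∈ , w∈ =
  u , v , w , (λ u≡v → x∈p∖y⇒x≢y v∈ (sym u≡v)) , (λ u≡w → x∈p∖y⇒x≢y w∈ (sym u≡w)) , v≢w ,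
  u∈ , x∈p∖y⇒x∈p v∈ , x∈p∖y⇒x∈p w∈

m+∣p∣≤n⇒m≤∣∁p∣ : ∀ {n} m (p : Subset n) → m + ∣ p ∣ ≤ n → m ≤ ∣ ∁ p ∣
m+∣p∣≤n⇒m≤∣∁p∣ m p le = subst (m ≤_) (sym (∣∁p∣≡n∸∣p∣ p)) (m+n≤o⇒m≤o∸n m le)

two-outside : ∀ {n} (D : Subset n) → 2 + ∣ D ∣ ≤ n → ∃₂ λ u v → u ≢ v × u ∉ D × v ∉ D
two-outside D le with two-elements (m+∣p∣≤n⇒m≤∣∁p∣ 2 D le)
... | u , v , u≢v , u∈ , v∈ = u , v , u≢v , x∈∁p⇒x∉p u∈ , x∈∁p⇒x∉p v∈

three-outside : ∀ {n} (D : Subset n) → 3 + ∣ D ∣ ≤ n →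
                ∃₂ λ u v → ∃ λ w → u ≢ v × u ≢ w × v ≢ w × u ∉ D × v ∉ D × w ∉ D
three-outside D le with three-elements (m+∣p∣≤n⇒m≤∣∁p∣ 3 D le)
... | u , v , w , u≢v , u≢w , v≢w , u∈ , v∈ , w∈ =
  u , v , w , u≢v , u≢w , v≢w , x∈∁p⇒x∉p u∈ , x∈∁p⇒x∉p v∈ , x∈∁p⇒x∉p w∈

∣⊤∖a∣ : ∀ {n} (a : Fin n) → 1 + ∣ ⊤ ∖ a ∣ ≡ n
∣⊤∖a∣ {n} a = trans (∣p∖x∣ {n} {a} {⊤} ∈⊤) (∣⊤∣≡n n)

∣⊤∖a∖b∣ : ∀ {n} {a b : Fin n} → a ≢ b → 2 + ∣ ⊤ ∖ a ∖ b ∣ ≡ n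
∣⊤∖a∖b∣ {a = a} {b} a≢b = trans (cong suc (∣p∖x∣ (x∈p∧x≢y⇒x∈p-y ∈⊤ (a≢b ∘ sym)))) (∣⊤∖a∣ a)

∣⊤∖a∖b∖c∣ : ∀ {n} {a b c : Fin n} → a ≢ b → a ≢ c → b ≢ c → 3 + ∣ ⊤ ∖ a ∖ b ∖ c ∣ ≡ n
∣⊤∖a∖b∖c∣ a≢b a≢c b≢c =
  trans (cong (λ k → suc (suc k)) (∣p∖x∣ (x∈p∧x≢y⇒x∈p-y (x∈p∧x≢y⇒x∈p-y ∈⊤ (a≢c ∘ sym)) (b≢c ∘ sym))))
        (∣⊤∖a∖b∣ a≢b)

∈⊤∖a : ∀ {n} {a x : Fin n} → x ≢ a → x ∈ ⊤ ∖ a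
∈⊤∖a = x∈p∧x≢y⇒x∈p-y ∈⊤

∈⊤∖a∖b : ∀ {n} {a b x : Fin n} → x ≢ a → x ≢ b → x ∈ ⊤ ∖ a ∖ b
∈⊤∖a∖b x≢a = x∈p∧x≢y⇒x∈p-y (∈⊤∖a x≢a)

∈⊤∖a∖b∖c : ∀ {n} {a b c x : Fin n} → x ≢ a → x ≢ b → x ≢ c → x ∈ ⊤ ∖ a ∖ b ∖ c
∈⊤∖a∖b∖c x≢a x≢b = x∈p∧x≢y⇒x∈p-y (∈⊤∖a∖b x≢a x≢b)

∉⊤∖a : ∀ {n} {a x : Fin n} → x ∉ ⊤ ∖ a → x ≡ a
∉⊤∖a = x∈p∧x∉p∖y⇒x≡y ∈⊤

∉⊤∖a∖b : ∀ {n} {a b x : Fin n} → x ∉ ⊤ ∖ a ∖ b → x ≡ a ⊎ x ≡ b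
∉⊤∖a∖b {a = a} {x = x} x∉ with x ≟ a
... | yes x≡a = inj₁ x≡a
... | no x≢a = inj₂ (x∈p∧x∉p∖y⇒x≡y (∈⊤∖a x≢a) x∉)

∉⊤∖a∖b∖c : ∀ {n} {a b c x : Fin n} → x ∉ ⊤ ∖ a ∖ b ∖ c → x ≡ a ⊎ x ≡ b ⊎ x ≡ c
∉⊤∖a∖b∖c {a = a} {b} {x = x} x∉ with x ≟ a | x ≟ b
... | yes x≡a | _ = inj₁ x≡a
... | no _ | yes x≡b = inj₂ (inj₁ x≡b)
... | no x≢a | no x≢b = inj₂ (inj₂ (x∈p∧x∉p∖y⇒x≡y (∈⊤∖a∖b x≢a x≢b) x∉))

-- Separated triples and resolving sets

module _ {m : ℕ} (H : Adj m) where

  SeparatedOutside : Fin m → Fin m → Fin m → Fin m → Fin m → Set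
  SeparatedOutside a b c p q = ∃ λ w → w ≢ a × w ≢ b × w ≢ c × H p w ≢ H q w

  NoSeparatedTriple : Set
  NoSeparatedTriple = ∀ a b c → a ≢ b → a ≢ c → b ≢ c →
    SeparatedOutside a b c a b → SeparatedOutside a b c a c → SeparatedOutside a b c b c → ⊥

  Diameter≤2 : Set
  Diameter≤2 = ∀ u v → u ≢ v → H u v ≡ false → ∃ λ c → H u c ≡ true × H c v ≡ true

LowerBound : ∀ {n} → Graph n → ℕ → ℕ → Set
LowerBound G k r = ∀ D → ResolvingDom G k D → r ≤ ∣ D ∣

module _ {n : ℕ} (G : Graph n) where

  Complete : Set
  Complete = ∀ u v → u ≢ v → adj G u v ≡ true

  resolving⇒separates : ∀ {D u v} → Resolving G D → u ≢ v → u ∉ D → v ∉ D →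
                        (∀ w → w ∈ D → dist G u w ≡ dist G v w) → ⊥
  resolving⇒separates res u≢v u∉ v∉ same with res _ _ u≢v u∉ v∉
  ... | w , w∈ , differ = differ (same w w∈)

  complete⇒¬resolving : Complete → ∀ D → Resolving G D → 2 + ∣ D ∣ ≤ n → ⊥
  complete⇒¬resolving complete D res le with two-outside D le
  ... | u , v , u≢v , u∉ , v∉ = resolving⇒separates res u≢v u∉ v∉ λ w w∈ →
    trans (adj⇒dist≡1 G (complete u w λ { refl → u∉ w∈ }))
          (sym (adj⇒dist≡1 G (complete v w λ { refl → v∉ w∈ })))

  inducedP3⇒resolvingDom : ∀ {u w v} k → 2 ≤ k → adj G u w ≡ true → adj G w v ≡ true →
                           adj G u v ≡ false → u ≢ v →
                           ResolvingDom G k (⊤ ∖ u ∖ w) × 2 + ∣ ⊤ ∖ u ∖ w ∣ ≡ n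
  inducedP3⇒resolvingDom {u} {w} {v} k 2≤k uw wv nuv u≢v =
    (resolving , dominating) , ∣⊤∖a∖b∣ (adj⇒≢ G uw)
    where
    v∈ : v ∈ ⊤ ∖ u ∖ w
    v∈ = ∈⊤∖a∖b (u≢v ∘ sym) (adj⇒≢ G wv ∘ sym)
    du : dist G u v ≡ just 2
    du = dist≡2 G u≢v nuv uw wv (≢⇒3≤ (adj⇒≢ G uw) u≢v (adj⇒≢ G wv))
    dw : dist G w v ≡ just 1
    dw = adj⇒dist≡1 G wv
    resolving : Resolving G (⊤ ∖ u ∖ w)
    resolving x y x≢y x∉ y∉ with ∉⊤∖a∖b x∉ | ∉⊤∖a∖b y∉
    ... | inj₁ refl | inj₁ refl = ⊥-elim (x≢y refl)
    ... | inj₂ refl | inj₂ refl = ⊥-elim (x≢y refl)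
    ... | inj₁ refl | inj₂ refl = v , v∈ , λ e → 2≢1 (just-injective (trans (sym du) (trans e dw)))
      where 2≢1 : 2 ≢ 1
            2≢1 ()
    ... | inj₂ refl | inj₁ refl = v , v∈ , λ e → 1≢2 (just-injective (trans (sym dw) (trans e du)))
      where 1≢2 : 1 ≢ 2
            1≢2 ()
    dominating : DistDominating G k (⊤ ∖ u ∖ w)
    dominating x x∉ with ∉⊤∖a∖b x∉
    ... | inj₁ refl = v , v∈ , 2 , trans (dist-sym G v u) du , 2≤k
    ... | inj₂ refl = v , v∈ , 1 , trans (dist-sym G v w) dw , ≤-trans (s≤s z≤n) 2≤k

  module Diameter2 (diam : Diameter≤2 (adj G)) (2<n : 2 < n) where

    dist≡1∨2 : ∀ {u v} → u ≢ v → dist G u v ≡ just (if adj G u v then 1 else 2)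
    dist≡1∨2 {u} {v} u≢v with adj G u v in e
    ... | true = adj⇒dist≡1 G e
    ... | false with diam u v u≢v e
    ...   | c , uc , cv = dist≡2 G u≢v e uc cv 2<n

    same-adj⇒same-dist : ∀ {u v w} → w ≢ u → w ≢ v → adj G u w ≡ adj G v w → dist G u w ≡ dist G v w
    same-adj⇒same-dist w≢u w≢v e =
      trans (dist≡1∨2 (w≢u ∘ sym)) (trans (cong (λ b → just (if b then 1 else 2)) e) (sym (dist≡1∨2 (w≢v ∘ sym))))

    adjacency-resolving : ∀ {D} → (∀ u v → u ≢ v → u ∉ D → v ∉ D → ∃ λ w → w ∈ D × adj G u w ≢ adj G v w) →
                          Resolving G D
    adjacency-resolving sep u v u≢v u∉ v∉ with sep u v u≢v u∉ v∉
    ... | w , w∈ , differ = w , w∈ , λ e → differ (if-injective (just-injective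
      (trans (sym (dist≡1∨2 λ { refl → u∉ w∈ })) (trans e (dist≡1∨2 λ { refl → v∉ w∈ })))))
      where
      if-injective : ∀ {a b} → (if a then 1 else 2) ≡ (if b then 1 else 2) → a ≡ b
      if-injective {true}  {true}  _ = refl
      if-injective {false} {false} _ = refl

    nonempty-dominating : ∀ k {D d} → 2 ≤ k → d ∈ D → DistDominating G k D
    nonempty-dominating k {D} {d} 2≤k d∈ v v∉ =
      d , d∈ , _ , dist≡1∨2 (λ { refl → v∉ d∈ }) , ≤-trans (≤2 (adj G d v)) 2≤k
      where
      ≤2 : ∀ b → (if b then 1 else 2) ≤ 2
      ≤2 true  = s≤s z≤n
      ≤2 false = ≤-refl

-- Joins, unions and vertex partitions

module _ {a b} (H₁ : Adj a) (H₂ : Adj b) {i j : Fin (a + b)} where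

  +G-ll : ∀ {x y} → splitAt a i ≡ inj₁ x → splitAt a j ≡ inj₁ y → (H₁ +G H₂) i j ≡ H₁ x y
  +G-ll e₁ e₂ with splitAt a i | splitAt a j
  +G-ll refl refl | _ | _ = refl

  +G-lr : ∀ {x y} → splitAt a i ≡ inj₁ x → splitAt a j ≡ inj₂ y → (H₁ +G H₂) i j ≡ true
  +G-lr e₁ e₂ with splitAt a i | splitAt a j
  +G-lr refl refl | _ | _ = refl

  +G-rl : ∀ {x y} → splitAt a i ≡ inj₂ x → splitAt a j ≡ inj₁ y → (H₁ +G H₂) i j ≡ true
  +G-rl e₁ e₂ with splitAt a i | splitAt a j
  +G-rl refl refl | _ | _ = refl

  +G-rr : ∀ {x y} → splitAt a i ≡ inj₂ x → splitAt a j ≡ inj₂ y → (H₁ +G H₂) i j ≡ H₂ x y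
  +G-rr e₁ e₂ with splitAt a i | splitAt a j
  +G-rr refl refl | _ | _ = refl

  ∪G-ll : ∀ {x y} → splitAt a i ≡ inj₁ x → splitAt a j ≡ inj₁ y → (H₁ ∪G H₂) i j ≡ H₁ x y
  ∪G-ll e₁ e₂ with splitAt a i | splitAt a j
  ∪G-ll refl refl | _ | _ = refl

  ∪G-lr : ∀ {x y} → splitAt a i ≡ inj₁ x → splitAt a j ≡ inj₂ y → (H₁ ∪G H₂) i j ≡ false
  ∪G-lr e₁ e₂ with splitAt a i | splitAt a j
  ∪G-lr refl refl | _ | _ = refl

  ∪G-rl : ∀ {x y} → splitAt a i ≡ inj₂ x → splitAt a j ≡ inj₁ y → (H₁ ∪G H₂) i j ≡ false
  ∪G-rl e₁ e₂ with splitAt a i | splitAt a j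
  ∪G-rl refl refl | _ | _ = refl

  ∪G-rr : ∀ {x y} → splitAt a i ≡ inj₂ x → splitAt a j ≡ inj₂ y → (H₁ ∪G H₂) i j ≡ H₂ x y
  ∪G-rr e₁ e₂ with splitAt a i | splitAt a j
  ∪G-rr refl refl | _ | _ = refl

splitAt-injective : ∀ a {b} {i j : Fin (a + b)} → splitAt a i ≡ splitAt a j → i ≡ j
splitAt-injective a {b} {i} {j} e =
  trans (sym (join-splitAt a b i)) (trans (cong (join a b) e) (join-splitAt a b j))

complete-≢ : ∀ {m} {x y : Fin m} → x ≢ y → complete m x y ≡ true
complete-≢ {x = x} {y} x≢y = cong not (⌊⌋-false (x ≟ y) x≢y)

inverses⇒≅ : ∀ {n m} (G : Graph n) (H : Adj m) (f : Fin n → Fin m) (g : Fin m → Fin n) →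
             (∀ x → g (f x) ≡ x) → (∀ y → f (g y) ≡ y) → (∀ u v → adj G u v ≡ H (f u) (f v)) → G ≅ H
inverses⇒≅ G H f g gf fg adj≡ =
  f , ((λ {x} {y} e → trans (sym (gf x)) (trans (cong g e) (gf y))) , λ y → g y , λ { refl → fg y }) , adj≡

module _ {n} (G : Graph n) {u v : Fin n} where

  ≡complete : ∀ {m} {i j : Fin m} → (i ≡ j → u ≡ v) → (u ≡ v → i ≡ j) → (u ≢ v → adj G u v ≡ true) →
              adj G u v ≡ complete m i j
  ≡complete {i = i} {j} i≡j⇒ u≡v⇒ adjacent with i ≟ j
  ... | yes i≡j rewrite i≡j⇒ i≡j = irrefl G _
  ... | no i≢j = adjacent (i≢j ∘ u≡v⇒)

  ≡emptyG : ∀ {m} {i j : Fin m} → (u ≢ v → adj G u v ≡ false) → adj G u v ≡ emptyG m i j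
  ≡emptyG nonadjacent with u ≟ v
  ... | yes refl = irrefl G _
  ... | no u≢v = nonadjacent u≢v

record Partition {n} (p : Fin n → Bool) : Set where
  field
    s t      : ℕ
    to       : Fin n → Fin s ⊎ Fin t
    from     : Fin s ⊎ Fin t → Fin n
    from-to  : ∀ x → from (to x) ≡ x
    to-from  : ∀ y → to (from y) ≡ y
    to-true  : ∀ x → p x ≡ true → ∃ λ i → to x ≡ inj₁ i
    to-false : ∀ x → p x ≡ false → ∃ λ j → to x ≡ inj₂ j

module _ {n} {p : Fin (suc n) → Bool} (P : Partition (p ∘ suc)) where
  open Partition P

  partition-suc-true : p zero ≡ true → Partition p
  partition-suc-true p₀ = record
    { s = suc s ; t = t ; to = to′ ; from = from′ ; from-to = from-to′ ; to-from = to-from′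
    ; to-true = to-true′ ; to-false = to-false′ }
    where
    to′ : Fin (suc n) → Fin (suc s) ⊎ Fin t
    to′ zero = inj₁ zero
    to′ (suc x) = map₁ suc (to x)
    from′ : Fin (suc s) ⊎ Fin t → Fin (suc n)
    from′ (inj₁ zero)    = zero
    from′ (inj₁ (suc i)) = suc (from (inj₁ i))
    from′ (inj₂ j)       = suc (from (inj₂ j))
    from-to′ : ∀ x → from′ (to′ x) ≡ x
    from-to′ zero = refl
    from-to′ (suc x) with to x in e
    ... | inj₁ i = cong suc (trans (cong from (sym e)) (from-to x))
    ... | inj₂ j = cong suc (trans (cong from (sym e)) (from-to x))
    to-from′ : ∀ y → to′ (from′ y) ≡ y
    to-from′ (inj₁ zero) = refl
    to-from′ (inj₁ (suc i)) = cong (map₁ suc) (to-from (inj₁ i))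
    to-from′ (inj₂ j) = cong (map₁ suc) (to-from (inj₂ j))
    to-true′ : ∀ x → p x ≡ true → ∃ λ i → to′ x ≡ inj₁ i
    to-true′ zero _ = zero , refl
    to-true′ (suc x) px = let (i , e) = to-true x px in suc i , cong (map₁ suc) e
    to-false′ : ∀ x → p x ≡ false → ∃ λ j → to′ x ≡ inj₂ j
    to-false′ zero px = ⊥-elim (true≢false (trans (sym p₀) px))
    to-false′ (suc x) px = let (j , e) = to-false x px in j , cong (map₁ suc) e

  partition-suc-false : p zero ≡ false → Partition p
  partition-suc-false p₀ = record
    { s = s ; t = suc t ; to = to′ ; from = from′ ; from-to = from-to′ ; to-from = to-from′
    ; to-true = to-true′ ; to-false = to-false′ }
    where
    to′ : Fin (suc n) → Fin s ⊎ Fin (suc t)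
    to′ zero = inj₂ zero
    to′ (suc x) = map₂ suc (to x)
    from′ : Fin s ⊎ Fin (suc t) → Fin (suc n)
    from′ (inj₂ zero)    = zero
    from′ (inj₂ (suc j)) = suc (from (inj₂ j))
    from′ (inj₁ i)       = suc (from (inj₁ i))
    from-to′ : ∀ x → from′ (to′ x) ≡ x
    from-to′ zero = refl
    from-to′ (suc x) with to x in e
    ... | inj₁ i = cong suc (trans (cong from (sym e)) (from-to x))
    ... | inj₂ j = cong suc (trans (cong from (sym e)) (from-to x))
    to-from′ : ∀ y → to′ (from′ y) ≡ y
    to-from′ (inj₂ zero) = refl
    to-from′ (inj₂ (suc j)) = cong (map₂ suc) (to-from (inj₂ j))
    to-from′ (inj₁ i) = cong (map₂ suc) (to-from (inj₁ i))
    to-true′ : ∀ x → p x ≡ true → ∃ λ i → to′ x ≡ inj₁ i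
    to-true′ zero px = ⊥-elim (true≢false (trans (sym px) p₀))
    to-true′ (suc x) px = let (i , e) = to-true x px in i , cong (map₂ suc) e
    to-false′ : ∀ x → p x ≡ false → ∃ λ j → to′ x ≡ inj₂ j
    to-false′ zero _ = zero , refl
    to-false′ (suc x) px = let (j , e) = to-false x px in suc j , cong (map₂ suc) e

partition : ∀ {n} (p : Fin n → Bool) → Partition p
partition {zero} p = record
  { s = 0 ; t = 0 ; to = λ () ; from = λ { (inj₁ ()) ; (inj₂ ()) } ; from-to = λ ()
  ; to-from = λ { (inj₁ ()) ; (inj₂ ()) } ; to-true = λ () ; to-false = λ () }
partition {suc n} p with p zero in p₀
... | true  = partition-suc-true (partition (p ∘ suc)) p₀
... | false = partition-suc-false (partition (p ∘ suc)) p₀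

module PartitionProperties {n} {p : Fin n → Bool} (P : Partition p) where
  open Partition P public

  to-injective : ∀ {u v} → to u ≡ to v → u ≡ v
  to-injective {u} {v} e = trans (sym (from-to u)) (trans (cong from e) (from-to v))

  inj₁⇒true : ∀ {u i} → to u ≡ inj₁ i → p u ≡ true
  inj₁⇒true {u} e with p u in pᵤ
  ... | true = refl
  ... | false with trans (sym e) (proj₂ (to-false u pᵤ))
  ...   | ()

  inj₂⇒false : ∀ {u j} → to u ≡ inj₂ j → p u ≡ false
  inj₂⇒false {u} e with p u in pᵤ
  ... | false = refl
  ... | true with trans (sym e) (proj₂ (to-true u pᵤ))
  ...   | ()

  from-injective : ∀ {a b} → from a ≡ from b → a ≡ b
  from-injective {a} {b} e = trans (sym (to-from a)) (trans (cong to e) (to-from b))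

  same-block₁ : ∀ {u v i j} → to u ≡ inj₁ i → to v ≡ inj₁ j → (i ≡ j → u ≡ v) × (u ≡ v → i ≡ j)
  same-block₁ eᵤ eᵥ = (λ { refl → to-injective (trans eᵤ (sym eᵥ)) }) , λ { refl → inj₁-injective (trans (sym eᵤ) eᵥ) }

  same-block₂ : ∀ {u v i j} → to u ≡ inj₂ i → to v ≡ inj₂ j → (i ≡ j → u ≡ v) × (u ≡ v → i ≡ j)
  same-block₂ eᵤ eᵥ = (λ { refl → to-injective (trans eᵤ (sym eᵥ)) }) , λ { refl → inj₂-injective (trans (sym eᵤ) eᵥ) }

  encode : Fin n → Fin (s + t)
  encode = join s t ∘ to

  decode : Fin (s + t) → Fin n
  decode = from ∘ splitAt s

  splitAt-encode : ∀ u → splitAt s (encode u) ≡ to u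
  splitAt-encode u = splitAt-join s t (to u)

  splitAt≡ : ∀ {u k} → to u ≡ k → splitAt s (encode u) ≡ k
  splitAt≡ {u} = trans (splitAt-encode u)

  decode-encode : ∀ u → decode (encode u) ≡ u
  decode-encode u = trans (cong from (splitAt-encode u)) (from-to u)

  encode-decode : ∀ y → encode (decode y) ≡ y
  encode-decode y = trans (cong (join s t) (to-from (splitAt s y))) (join-splitAt s t y)

  module _ (A : Adj n) {H₁ : Adj s} {H₂ : Adj t}
    (ll : ∀ {u v i j} → to u ≡ inj₁ i → to v ≡ inj₁ j → A u v ≡ H₁ i j)
    (rr : ∀ {u v i j} → to u ≡ inj₂ i → to v ≡ inj₂ j → A u v ≡ H₂ i j) where

    partition-join : (∀ {u v i j} → to u ≡ inj₁ i → to v ≡ inj₂ j → A u v ≡ true) →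
                     (∀ {u v i j} → to u ≡ inj₂ i → to v ≡ inj₁ j → A u v ≡ true) →
                     ∀ u v → A u v ≡ (H₁ +G H₂) (encode u) (encode v)
    partition-join lr rl u v = cases (to u) refl (to v) refl
      where
      cases : ∀ kᵤ → to u ≡ kᵤ → ∀ kᵥ → to v ≡ kᵥ → A u v ≡ (H₁ +G H₂) (encode u) (encode v)
      cases (inj₁ _) eᵤ (inj₁ _) eᵥ = trans (ll eᵤ eᵥ) (sym (+G-ll H₁ H₂ (splitAt≡ eᵤ) (splitAt≡ eᵥ)))
      cases (inj₁ _) eᵤ (inj₂ _) eᵥ = trans (lr eᵤ eᵥ) (sym (+G-lr H₁ H₂ (splitAt≡ eᵤ) (splitAt≡ eᵥ)))
      cases (inj₂ _) eᵤ (inj₁ _) eᵥ = trans (rl eᵤ eᵥ) (sym (+G-rl H₁ H₂ (splitAt≡ eᵤ) (splitAt≡ eᵥ)))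
      cases (inj₂ _) eᵤ (inj₂ _) eᵥ = trans (rr eᵤ eᵥ) (sym (+G-rr H₁ H₂ (splitAt≡ eᵤ) (splitAt≡ eᵥ)))

    partition-union : (∀ {u v i j} → to u ≡ inj₁ i → to v ≡ inj₂ j → A u v ≡ false) →
                      (∀ {u v i j} → to u ≡ inj₂ i → to v ≡ inj₁ j → A u v ≡ false) →
                      ∀ u v → A u v ≡ (H₁ ∪G H₂) (encode u) (encode v)
    partition-union lr rl u v = cases (to u) refl (to v) refl
      where
      cases : ∀ kᵤ → to u ≡ kᵤ → ∀ kᵥ → to v ≡ kᵥ → A u v ≡ (H₁ ∪G H₂) (encode u) (encode v)
      cases (inj₁ _) eᵤ (inj₁ _) eᵥ = trans (ll eᵤ eᵥ) (sym (∪G-ll H₁ H₂ (splitAt≡ eᵤ) (splitAt≡ eᵥ)))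
      cases (inj₁ _) eᵤ (inj₂ _) eᵥ = trans (lr eᵤ eᵥ) (sym (∪G-lr H₁ H₂ (splitAt≡ eᵤ) (splitAt≡ eᵥ)))
      cases (inj₂ _) eᵤ (inj₁ _) eᵥ = trans (rl eᵤ eᵥ) (sym (∪G-rl H₁ H₂ (splitAt≡ eᵤ) (splitAt≡ eᵥ)))
      cases (inj₂ _) eᵤ (inj₂ _) eᵥ = trans (rr eᵤ eᵥ) (sym (∪G-rr H₁ H₂ (splitAt≡ eᵤ) (splitAt≡ eᵥ)))

  partition⇒≅ : ∀ (G : Graph n) (H : Adj (s + t)) → (∀ u v → adj G u v ≡ H (encode u) (encode v)) → G ≅ H
  partition⇒≅ G H = inverses⇒≅ G H encode decode decode-encode encode-decode

relabelʳ : ∀ {n} {p : Fin n → Bool} (P : Partition p) {m} (g : Fin (Partition.t P) → Fin m) (h : Fin m → Fin (Partition.t P)) →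
           (∀ x → h (g x) ≡ x) → (∀ y → g (h y) ≡ y) → Partition p
relabelʳ P {m} g h hg gh = record
  { s = s ; t = m ; to = map₂ g ∘ to ; from = from ∘ map₂ h
  ; from-to = λ x → trans (cong from (map₂-inverse hg (to x))) (from-to x)
  ; to-from = λ y → trans (cong (map₂ g) (to-from (map₂ h y))) (map₂-inverse gh y)
  ; to-true = λ x px → let (i , e) = to-true x px in i , cong (map₂ g) e
  ; to-false = λ x px → let (j , e) = to-false x px in g j , cong (map₂ g) e }
  where
  open Partition P
  map₂-inverse : ∀ {A B C : Set} {f : B → C} {f⁻¹ : C → B} → (∀ x → f⁻¹ (f x) ≡ x) →
                 ∀ (y : A ⊎ B) → map₂ f⁻¹ (map₂ f y) ≡ y
  map₂-inverse inv (inj₁ a) = refl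
  map₂-inverse inv (inj₂ b) = cong inj₂ (inv b)

map₂-inj₂⁻ : ∀ {A B C : Set} {f : B → C} {f⁻¹ : C → B} → (∀ x → f⁻¹ (f x) ≡ x) →
             ∀ {y : A ⊎ B} {k} → map₂ f y ≡ inj₂ k → y ≡ inj₂ (f⁻¹ k)
map₂-inj₂⁻ inv {inj₂ b} refl = cong inj₂ (sym (inv b))

-- Configurations forcing a separated triple

-- A graph on Fin m, stored as the rows of its adjacency matrix above the diagonal.
Pattern : ℕ → Set
Pattern zero    = Unit
Pattern (suc m) = Vec Bool m × Pattern m

edge : ∀ {m} → Pattern m → Adj m
edge {suc m} (r , P) zero    zero    = false
edge {suc m} (r , P) zero    (suc j) = lookup r j
edge {suc m} (r , P) (suc i) zero    = lookup r i
edge {suc m} (r , P) (suc i) (suc j) = edge P i j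

allVec : ∀ m → (Vec Bool m → Bool) → Bool
allVec zero    f = f []
allVec (suc m) f = allVec m (f ∘ (true ∷_)) ∧ allVec m (f ∘ (false ∷_))

allVec-sound : ∀ m (f : Vec Bool m → Bool) → allVec m f ≡ true → ∀ v → f v ≡ true
allVec-sound zero    f e []          = e
allVec-sound (suc m) f e (true ∷ v)  = allVec-sound m _ (proj₁ (∧-elim (allVec m _) e)) v
allVec-sound (suc m) f e (false ∷ v) = allVec-sound m _ (proj₂ (∧-elim (allVec m _) e)) v

allPatterns : ∀ m → (Pattern m → Bool) → Bool
allPatterns zero    f = f tt
allPatterns (suc m) f = allPatterns m (λ P → allVec m (λ r → f (r , P)))

allPatterns-sound : ∀ m (f : Pattern m → Bool) → allPatterns m f ≡ true → ∀ P → f P ≡ true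
allPatterns-sound zero    f e tt      = e
allPatterns-sound (suc m) f e (r , P) = allVec-sound m _ (allPatterns-sound m _ e P) r

allFin : ∀ {n} → (Fin n → Bool) → Bool
allFin {zero}  f = true
allFin {suc n} f = f zero ∧ allFin (f ∘ suc)

allFin-intro : ∀ {n} (f : Fin n → Bool) → (∀ i → f i ≡ true) → allFin f ≡ true
allFin-intro {zero}  f h = refl
allFin-intro {suc n} f h = ∧-intro (h zero) (allFin-intro _ (h ∘ suc))

_≠_ : ∀ {m} → Fin m → Fin m → Bool
i ≠ j = not ⌊ i ≟ j ⌋

≠⇒≢ : ∀ {m} {i j : Fin m} → i ≠ j ≡ true → i ≢ j
≠⇒≢ {i = i} {j} = ⌊⌋≡false⇒¬ (i ≟ j) ∘ not≡true⇒≡false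

separatedᵇ : ∀ {m} → Pattern m → Fin m → Fin m → Fin m → Fin m → Fin m → Bool
separatedᵇ P i j l p q = anyFin λ w → w ≠ i ∧ w ≠ j ∧ w ≠ l ∧ (edge P p w xor edge P q w)

noSeparatedTripleᵇ : ∀ {m} → Pattern m → Bool
noSeparatedTripleᵇ P = allFin λ i → allFin λ j → allFin λ l →
  not (i ≠ j ∧ i ≠ l ∧ j ≠ l) ∨ not (separatedᵇ P i j l i j ∧ separatedᵇ P i j l i l ∧ separatedᵇ P i j l j l)

Constraint : ℕ → Set
Constraint m = Fin m × Fin m × Bool

satisfiesᵇ : ∀ {m} → List (Constraint m) → Pattern m → Bool
satisfiesᵇ []                  P = true
satisfiesᵇ ((i , j , b) ∷ cs) P = (if b then edge P i j else not (edge P i j)) ∧ satisfiesᵇ cs P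

Unrealisable : ∀ {m} → List (Constraint m) → Set
Unrealisable {m} cs = allPatterns m (λ P → not (satisfiesᵇ cs P ∧ noSeparatedTripleᵇ P)) ≡ true

module _ {n : ℕ} (G : Graph n) where

  patternOf : ∀ {m} → (Fin m → Fin n) → Pattern m
  patternOf {zero}  t = tt
  patternOf {suc m} t = tabulate (λ j → adj G (t zero) (t (suc j))) , patternOf (t ∘ suc)

  edge-patternOf : ∀ {m} (t : Fin m → Fin n) i j → edge (patternOf t) i j ≡ adj G (t i) (t j)
  edge-patternOf {suc m} t zero    zero    = sym (irrefl G (t zero))
  edge-patternOf {suc m} t zero    (suc j) = lookup∘tabulate _ j
  edge-patternOf {suc m} t (suc i) zero    = trans (lookup∘tabulate _ i) (adj-sym G _ _)
  edge-patternOf {suc m} t (suc i) (suc j) = edge-patternOf (t ∘ suc) i j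

  module _ {m} (t : Fin m → Fin n) (t-injective : ∀ {i j} → t i ≡ t j → i ≡ j) where

    ≠-image : ∀ {i j} → i ≠ j ≡ true → t i ≢ t j
    ≠-image e = ≠⇒≢ e ∘ t-injective

    separatedᵇ-sound : ∀ i j l p q → separatedᵇ (patternOf t) i j l p q ≡ true →
                       SeparatedOutside (adj G) (t i) (t j) (t l) (t p) (t q)
    separatedᵇ-sound i j l p q e with anyFin-elim _ e
    ... | w , ew with ∧-elim (w ≠ i) ew
    ...   | w≠i , ew₁ with ∧-elim (w ≠ j) ew₁
    ...     | w≠j , ew₂ with ∧-elim (w ≠ l) ew₂
    ...       | w≠l , differ = t w , ≠-image w≠i , ≠-image w≠j , ≠-image w≠l ,
      λ x → xor≡true⇒≢ differ (trans (edge-patternOf t p w) (trans x (sym (edge-patternOf t q w))))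
      where
      xor≡true⇒≢ : ∀ {a b} → (a xor b) ≡ true → a ≢ b
      xor≡true⇒≢ {true}  {true}  ()
      xor≡true⇒≢ {false} {false} ()

    noSeparatedTripleᵇ-patternOf : NoSeparatedTriple (adj G) → noSeparatedTripleᵇ (patternOf t) ≡ true
    noSeparatedTripleᵇ-patternOf noSep = allFin-intro _ λ i → allFin-intro _ λ j → allFin-intro _ λ l →
      ≢false⇒≡true λ f → triple i j l (not∨not≡false f)
      where
      not∨not≡false : ∀ {a b} → (not a ∨ not b) ≡ false → a ≡ true × b ≡ true
      not∨not≡false {true} {true} _ = refl , refl
      sep : Fin m → Fin m → Fin m → Fin m → Fin m → Bool
      sep = separatedᵇ (patternOf t)
      triple : ∀ i j l → (i ≠ j ∧ i ≠ l ∧ j ≠ l) ≡ true × (sep i j l i j ∧ sep i j l i l ∧ sep i j l j l) ≡ true → ⊥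
      triple i j l (d , s) with ∧-elim (i ≠ j) d | ∧-elim (sep i j l i j) s
      ... | i≠j , d′ | sᵢⱼ , s′ with ∧-elim (i ≠ l) d′ | ∧-elim (sep i j l i l) s′
      ...   | i≠l , j≠l | sᵢₗ , sⱼₗ = noSep (t i) (t j) (t l) (≠-image i≠j) (≠-image i≠l) (≠-image j≠l)
        (separatedᵇ-sound i j l i j sᵢⱼ) (separatedᵇ-sound i j l i l sᵢₗ) (separatedᵇ-sound i j l j l sⱼₗ)

  Holds : ∀ {m} → Vec (Fin n) m → Constraint m → Set
  Holds vs (i , j , b) = adj G (lookup vs i) (lookup vs j) ≡ b

  satisfiesᵇ-patternOf : ∀ {m} (vs : Vec (Fin n) m) {cs} → All (Holds vs) cs → satisfiesᵇ cs (patternOf (lookup vs)) ≡ true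
  satisfiesᵇ-patternOf vs [] = refl
  satisfiesᵇ-patternOf vs {(i , j , b) ∷ cs} (h ∷ hs) =
    ∧-intro (holds b (trans (edge-patternOf (lookup vs) i j) h)) (satisfiesᵇ-patternOf vs hs)
    where
    holds : ∀ b {x} → x ≡ b → (if b then x else not x) ≡ true
    holds true  refl = refl
    holds false refl = refl

  unrealisable : NoSeparatedTriple (adj G) → ∀ {m} (cs : List (Constraint m)) → Unrealisable cs →
                 (vs : Vec (Fin n) m) → Unique vs → All (Holds vs) cs → ⊥
  unrealisable noSep {m} cs unreal vs distinct holds
    with allPatterns-sound m _ unreal (patternOf (lookup vs))
  ... | e rewrite satisfiesᵇ-patternOf vs holds
                | noSeparatedTripleᵇ-patternOf (lookup vs) (λ {i} {j} → lookup-injective distinct i j) noSep = true≢false (sym e)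

neighbour-config₁ : List (Constraint 5)
neighbour-config₁ =
  (# 0 , # 1 , false) ∷ (# 0 , # 2 , false) ∷ (# 1 , # 2 , true) ∷ (# 0 , # 3 , true) ∷
  (# 1 , # 3 , false) ∷ (# 2 , # 3 , true) ∷ (# 1 , # 4 , true) ∷ (# 0 , # 4 , true) ∷ []

neighbour-config₁-unrealisable : Unrealisable neighbour-config₁
neighbour-config₁-unrealisable = refl

neighbour-config₂ : List (Constraint 5)
neighbour-config₂ =
  (# 0 , # 1 , false) ∷ (# 0 , # 2 , false) ∷ (# 1 , # 2 , true) ∷ (# 0 , # 3 , true) ∷
  (# 1 , # 3 , false) ∷ (# 2 , # 3 , false) ∷ (# 3 , # 4 , true) ∷ (# 1 , # 4 , true) ∷ []

neighbour-config₂-unrealisable : Unrealisable neighbour-config₂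
neighbour-config₂-unrealisable = refl

universal-config : List (Constraint 5)
universal-config =
  (# 0 , # 1 , false) ∷ (# 0 , # 2 , false) ∷ (# 1 , # 2 , true) ∷ (# 0 , # 3 , true) ∷
  (# 1 , # 3 , true) ∷ (# 2 , # 3 , true) ∷ (# 3 , # 4 , false) ∷ []

universal-config-unrealisable : Unrealisable universal-config
universal-config-unrealisable = refl

clique-config₁ : List (Constraint 5)
clique-config₁ =
  (# 0 , # 1 , false) ∷ (# 0 , # 2 , false) ∷ (# 1 , # 2 , true) ∷ (# 0 , # 3 , false) ∷
  (# 1 , # 3 , false) ∷ (# 0 , # 4 , true) ∷ (# 1 , # 4 , true) ∷ (# 2 , # 4 , true) ∷ (# 3 , # 4 , true) ∷ []

clique-config₁-unrealisable : Unrealisable clique-config₁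
clique-config₁-unrealisable = refl

clique-config₂ : List (Constraint 6)
clique-config₂ =
  (# 0 , # 1 , false) ∷ (# 0 , # 2 , false) ∷ (# 1 , # 2 , true) ∷ (# 0 , # 3 , false) ∷
  (# 0 , # 4 , false) ∷ (# 3 , # 4 , false) ∷ (# 0 , # 5 , true) ∷ (# 1 , # 5 , true) ∷
  (# 2 , # 5 , true) ∷ (# 3 , # 5 , true) ∷ (# 4 , # 5 , true) ∷ []

clique-config₂-unrealisable : Unrealisable clique-config₂
clique-config₂-unrealisable = refl

-- The exceptional families

TwinsOutside : ∀ {m} → Adj m → Fin m → Fin m → Set
TwinsOutside H p q = ∀ w → w ≢ p → w ≢ q → H p w ≡ H q w

complete-twins : ∀ m (p q : Fin m) → TwinsOutside (complete m) p q
complete-twins m p q w w≢p w≢q = trans (complete-≢ (w≢p ∘ sym)) (sym (complete-≢ (w≢q ∘ sym)))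

emptyG-twins : ∀ m (p q : Fin m) → TwinsOutside (emptyG m) p q
emptyG-twins m p q w _ _ = refl

agree⇒¬separated : ∀ {m} {H : Adj m} {a b c p q} →
  (∀ w → w ≢ a → w ≢ b → w ≢ c → H p w ≡ H q w) → SeparatedOutside H a b c p q → ⊥
agree⇒¬separated agree (w , w≢a , w≢b , w≢c , differ) = differ (agree w w≢a w≢b w≢c)

data Label : Set where
  left middle right : Label

-- Among three distinct vertices either two carry the same end label (twins), or two carry the middle
-- label (impossible), or the labels are left, middle and right in some order.
module _ {m} (H : Adj m) (label : Fin m → Label)
  (same-end : ∀ {p q l} → l ≢ middle → label p ≡ l → label q ≡ l → TwinsOutside H p q)
  (unique-middle : ∀ {p q} → label p ≡ middle → label q ≡ middle → p ≡ q)
  (left-right : ∀ {p q r} → label p ≡ left → label q ≡ right → label r ≡ middle →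
                ∀ w → w ≢ r → w ≢ p → w ≢ q → H p w ≡ H q w) where

  labelled⇒NoSeparatedTriple : NoSeparatedTriple H
  labelled⇒NoSeparatedTriple a b c a≢b a≢c b≢c sab sac sbc = cases (label a) (label b) (label c) refl refl refl
    where
    ¬ab : (∀ w → w ≢ a → w ≢ b → w ≢ c → H a w ≡ H b w) → ⊥
    ¬ab agree = agree⇒¬separated {H = H} agree sab
    ¬ac : (∀ w → w ≢ a → w ≢ b → w ≢ c → H a w ≡ H c w) → ⊥
    ¬ac agree = agree⇒¬separated {H = H} agree sac
    ¬bc : (∀ w → w ≢ a → w ≢ b → w ≢ c → H b w ≡ H c w) → ⊥
    ¬bc agree = agree⇒¬separated {H = H} agree sbc
    cases : ∀ la lb lc → label a ≡ la → label b ≡ lb → label c ≡ lc → ⊥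
    cases left   left   _      ea eb _  = ¬ab λ w wa wb _  → same-end (λ ()) ea eb w wa wb
    cases right  right  _      ea eb _  = ¬ab λ w wa wb _  → same-end (λ ()) ea eb w wa wb
    cases left   _      left   ea _  ec = ¬ac λ w wa _  wc → same-end (λ ()) ea ec w wa wc
    cases right  _      right  ea _  ec = ¬ac λ w wa _  wc → same-end (λ ()) ea ec w wa wc
    cases _      left   left   _  eb ec = ¬bc λ w _  wb wc → same-end (λ ()) eb ec w wb wc
    cases _      right  right  _  eb ec = ¬bc λ w _  wb wc → same-end (λ ()) eb ec w wb wc
    cases middle middle _      ea eb _  = a≢b (unique-middle ea eb)
    cases middle _      middle ea _  ec = a≢c (unique-middle ea ec)
    cases _      middle middle _  eb ec = b≢c (unique-middle eb ec)
    cases left   middle right  ea eb ec = ¬ac λ w wa wb wc → left-right ea ec eb w wb wa wc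
    cases left   right  middle ea eb ec = ¬ab λ w wa wb wc → left-right ea eb ec w wc wa wb
    cases middle left   right  ea eb ec = ¬bc λ w wa wb wc → left-right eb ec ea w wa wb wc
    cases middle right  left   ea eb ec = ¬bc λ w wa wb wc → sym (left-right ec eb ea w wa wc wb)
    cases right  left   middle ea eb ec = ¬ab λ w wa wb wc → sym (left-right eb ea ec w wc wb wa)
    cases right  middle left   ea eb ec = ¬ac λ w wa wb wc → sym (left-right ec ea eb w wb wc wa)

module JoinProperties {s t} (H₁ : Adj s) (H₂ : Adj t) where

  side : ∀ (i : Fin (s + t)) → (∃ λ x → splitAt s i ≡ inj₁ x) ⊎ (∃ λ y → splitAt s i ≡ inj₂ y)
  side i with splitAt s i
  ... | inj₁ x = inj₁ (x , refl)
  ... | inj₂ y = inj₂ (y , refl)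

  ≢ˡ : ∀ {i w : Fin (s + t)} {x z} → splitAt s i ≡ inj₁ x → splitAt s w ≡ inj₁ z → w ≢ i → z ≢ x
  ≢ˡ eᵢ e_w w≢i refl = w≢i (splitAt-injective s (trans e_w (sym eᵢ)))

  ≢ʳ : ∀ {i w : Fin (s + t)} {x z} → splitAt s i ≡ inj₂ x → splitAt s w ≡ inj₂ z → w ≢ i → z ≢ x
  ≢ʳ eᵢ e_w w≢i refl = w≢i (splitAt-injective s (trans e_w (sym eᵢ)))

  twins-left : ∀ {i j : Fin (s + t)} {x y} → TwinsOutside H₁ x y → splitAt s i ≡ inj₁ x → splitAt s j ≡ inj₁ y →
               TwinsOutside (H₁ +G H₂) i j
  twins-left {i} {j} tw eᵢ eⱼ w w≢i w≢j with side w
  ... | inj₁ (z , e_w) =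
    trans (+G-ll H₁ H₂ {i} {w} eᵢ e_w) (trans (tw z (≢ˡ eᵢ e_w w≢i) (≢ˡ eⱼ e_w w≢j)) (sym (+G-ll H₁ H₂ {j} {w} eⱼ e_w)))
  ... | inj₂ (z , e_w) = trans (+G-lr H₁ H₂ {i} {w} eᵢ e_w) (sym (+G-lr H₁ H₂ {j} {w} eⱼ e_w))

  twins-right : ∀ {i j : Fin (s + t)} {x y} → TwinsOutside H₂ x y → splitAt s i ≡ inj₂ x → splitAt s j ≡ inj₂ y →
                TwinsOutside (H₁ +G H₂) i j
  twins-right {i} {j} tw eᵢ eⱼ w w≢i w≢j with side w
  ... | inj₂ (z , e_w) =
    trans (+G-rr H₁ H₂ {i} {w} eᵢ e_w) (trans (tw z (≢ʳ eᵢ e_w w≢i) (≢ʳ eⱼ e_w w≢j)) (sym (+G-rr H₁ H₂ {j} {w} eⱼ e_w)))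
  ... | inj₁ (z , e_w) = trans (+G-rl H₁ H₂ {i} {w} eᵢ e_w) (sym (+G-rl H₁ H₂ {j} {w} eⱼ e_w))

  join-diameter≤2 : 1 ≤ s → (∀ x y → x ≢ y → H₁ x y ≡ true) → Diameter≤2 (H₁ +G H₂)
  join-diameter≤2 (s≤s {n = s′} _) clique i j i≢j nonadj with side i | side j
  ... | inj₁ (x , eᵢ) | inj₁ (y , eⱼ) =
    ⊥-elim (true≢false (trans (sym (clique x y λ { refl → i≢j (splitAt-injective s (trans eᵢ (sym eⱼ))) }))
                              (trans (sym (+G-ll H₁ H₂ {i} {j} eᵢ eⱼ)) nonadj)))
  ... | inj₁ (x , eᵢ) | inj₂ (y , eⱼ) = ⊥-elim (true≢false (trans (sym (+G-lr H₁ H₂ {i} {j} eᵢ eⱼ)) nonadj))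
  ... | inj₂ (x , eᵢ) | inj₁ (y , eⱼ) = ⊥-elim (true≢false (trans (sym (+G-rl H₁ H₂ {i} {j} eᵢ eⱼ)) nonadj))
  ... | inj₂ (x , eᵢ) | inj₂ (y , eⱼ) =
    zero ↑ˡ t , +G-rl H₁ H₂ {i} {zero ↑ˡ t} eᵢ e₀ , +G-lr H₁ H₂ {zero ↑ˡ t} {j} e₀ eⱼ
    where
    e₀ : splitAt s (zero ↑ˡ t) ≡ inj₁ zero
    e₀ = splitAt-↑ˡ (suc s′) zero t

  twin-blocks⇒NoSeparatedTriple : (∀ x y → TwinsOutside H₁ x y) → (∀ x y → TwinsOutside H₂ x y) →
                                  NoSeparatedTriple (H₁ +G H₂)
  twin-blocks⇒NoSeparatedTriple tw₁ tw₂ = labelled⇒NoSeparatedTriple (H₁ +G H₂) label same-end unique-middle left-right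
    where
    label : Fin (s + t) → Label
    label i = [ (λ _ → left) , (λ _ → right) ]′ (splitAt s i)
    label-left : ∀ {p} → label p ≡ left → ∃ λ x → splitAt s p ≡ inj₁ x
    label-left {p} e with splitAt s p
    ... | inj₁ x = x , refl
    label-left () | inj₂ _
    label-right : ∀ {p} → label p ≡ right → ∃ λ y → splitAt s p ≡ inj₂ y
    label-right {p} e with splitAt s p
    ... | inj₂ y = y , refl
    label-right () | inj₁ _
    same-end : ∀ {p q l} → l ≢ middle → label p ≡ l → label q ≡ l → TwinsOutside (H₁ +G H₂) p q
    same-end {l = left} _ lₚ l_q with label-left lₚ | label-left l_q
    ... | x , eₚ | y , e_q = twins-left (tw₁ x y) eₚ e_q
    same-end {l = middle} ¬m _ _ = ⊥-elim (¬m refl)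
    same-end {l = right} _ lₚ l_q with label-right lₚ | label-right l_q
    ... | x , eₚ | y , e_q = twins-right (tw₂ x y) eₚ e_q
    no-middle : ∀ {p} → label p ≢ middle
    no-middle {p} with splitAt s p
    ... | inj₁ _ = λ ()
    ... | inj₂ _ = λ ()
    unique-middle : ∀ {p q} → label p ≡ middle → label q ≡ middle → p ≡ q
    unique-middle lₚ = ⊥-elim (no-middle lₚ)
    left-right : ∀ {p q r} → label p ≡ left → label q ≡ right → label r ≡ middle → ∀ w → w ≢ r → w ≢ p → w ≢ q →
                 (H₁ +G H₂) p w ≡ (H₁ +G H₂) q w
    left-right _ _ lᵣ = ⊥-elim (no-middle lᵣ)

∪G-twins-right : ∀ {a b} (H₁ : Adj a) (H₂ : Adj b) {i j : Fin (a + b)} {x y} → TwinsOutside H₂ x y →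
                 splitAt a i ≡ inj₂ x → splitAt a j ≡ inj₂ y → TwinsOutside (H₁ ∪G H₂) i j
∪G-twins-right {a} H₁ H₂ {i} {j} tw eᵢ eⱼ w w≢i w≢j with JoinProperties.side H₁ H₂ w
... | inj₁ (z , e_w) = trans (∪G-rl H₁ H₂ {i} {w} eᵢ e_w) (sym (∪G-rl H₁ H₂ {j} {w} eⱼ e_w))
... | inj₂ (z , e_w) =
  trans (∪G-rr H₁ H₂ {i} {w} eᵢ e_w)
        (trans (tw z (JoinProperties.≢ʳ H₁ H₂ eᵢ e_w w≢i) (JoinProperties.≢ʳ H₁ H₂ eⱼ e_w w≢j))
               (sym (∪G-rr H₁ H₂ {j} {w} eⱼ e_w)))

two-distinct : ∀ {t} → 2 ≤ t → Σ (Fin t) λ a → Σ (Fin t) λ b → a ≢ b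
two-distinct (s≤s (s≤s _)) = zero , suc zero , λ ()

module CompleteBipartite (s t : ℕ) (1≤s : 1 ≤ s) (1≤t : 1 ≤ t) where
  open JoinProperties (emptyG s) (emptyG t)

  completeBip-NoSeparatedTriple : NoSeparatedTriple (completeBip s t)
  completeBip-NoSeparatedTriple = twin-blocks⇒NoSeparatedTriple (emptyG-twins s) (emptyG-twins t)

  completeBip-diameter≤2 : Diameter≤2 (completeBip s t)
  completeBip-diameter≤2 i j i≢j nonadj with side i | side j
  ... | inj₁ (x , eᵢ) | inj₂ (y , eⱼ) = ⊥-elim (true≢false (trans (sym (+G-lr _ _ {i} {j} eᵢ eⱼ)) nonadj))
  ... | inj₂ (x , eᵢ) | inj₁ (y , eⱼ) = ⊥-elim (true≢false (trans (sym (+G-rl _ _ {i} {j} eᵢ eⱼ)) nonadj))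
  ... | inj₁ (x , eᵢ) | inj₁ (y , eⱼ) = c , +G-lr _ _ {i} {c} eᵢ e_c , +G-rl _ _ {c} {j} e_c eⱼ
    where
    c : Fin (s + t)
    c = s ↑ʳ fromℕ< 1≤t
    e_c : splitAt s c ≡ inj₂ (fromℕ< 1≤t)
    e_c = splitAt-↑ʳ s t _
  ... | inj₂ (x , eᵢ) | inj₂ (y , eⱼ) = c , +G-rl _ _ {i} {c} eᵢ e_c , +G-lr _ _ {c} {j} e_c eⱼ
    where
    c : Fin (s + t)
    c = fromℕ< 1≤s ↑ˡ t
    e_c : splitAt s c ≡ inj₁ (fromℕ< 1≤s)
    e_c = splitAt-↑ˡ s _ t

  completeBip-nonadjacent : 4 ≤ s + t → ∃₂ λ i j → i ≢ j × completeBip s t i j ≡ false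
  completeBip-nonadjacent 4≤s+t with 2≤s⊎2≤t s 4≤s+t
    where
    2≤s⊎2≤t : ∀ s → 4 ≤ s + t → 2 ≤ s ⊎ 2 ≤ t
    2≤s⊎2≤t (suc (suc s)) _        = inj₁ (s≤s (s≤s z≤n))
    2≤s⊎2≤t zero          le       = inj₂ (≤-trans (s≤s (s≤s z≤n)) le)
    2≤s⊎2≤t (suc zero)    (s≤s le) = inj₂ (≤-trans (s≤s (s≤s z≤n)) le)
  ... | inj₁ 2≤s with two-distinct 2≤s
  ...   | a , b , a≢b = a ↑ˡ t , b ↑ˡ t , a≢b ∘ ↑ˡ-injective t a b ,
                        +G-ll _ _ {a ↑ˡ t} {b ↑ˡ t} (splitAt-↑ˡ s a t) (splitAt-↑ˡ s b t)
  completeBip-nonadjacent _ | inj₂ 2≤t with two-distinct 2≤t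
  ...   | a , b , a≢b = s ↑ʳ a , s ↑ʳ b , a≢b ∘ ↑ʳ-injective s a b ,
                        +G-rr _ _ {s ↑ʳ a} {s ↑ʳ b} (splitAt-↑ʳ s t a) (splitAt-↑ʳ s t b)

module CliqueJoinIndependent (s t : ℕ) (1≤s : 1 ≤ s) (2≤t : 2 ≤ t) where
  open JoinProperties (complete s) (emptyG t)

  cliqueJoinIndependent-NoSeparatedTriple : NoSeparatedTriple (complete s +G emptyG t)
  cliqueJoinIndependent-NoSeparatedTriple = twin-blocks⇒NoSeparatedTriple (complete-twins s) (emptyG-twins t)

  cliqueJoinIndependent-diameter≤2 : Diameter≤2 (complete s +G emptyG t)
  cliqueJoinIndependent-diameter≤2 = join-diameter≤2 1≤s (λ _ _ → complete-≢)

  cliqueJoinIndependent-nonadjacent : ∃₂ λ i j → i ≢ j × (complete s +G emptyG t) i j ≡ false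
  cliqueJoinIndependent-nonadjacent with two-distinct 2≤t
  ... | a , b , a≢b = s ↑ʳ a , s ↑ʳ b , a≢b ∘ ↑ʳ-injective s a b ,
                      +G-rr _ _ {s ↑ʳ a} {s ↑ʳ b} (splitAt-↑ʳ s t a) (splitAt-↑ʳ s t b)

module CliqueJoinK₁∪Clique (s t : ℕ) (1≤s : 1 ≤ s) (1≤t : 1 ≤ t) where
  H₂ : Adj (1 + t)
  H₂ = complete 1 ∪G complete t
  H : Adj (s + (1 + t))
  H = complete s +G H₂
  open JoinProperties (complete s) H₂
  module Inner = JoinProperties (complete 1) (complete t)

  cliqueJoinK₁∪Clique-diameter≤2 : Diameter≤2 H
  cliqueJoinK₁∪Clique-diameter≤2 = join-diameter≤2 1≤s (λ _ _ → complete-≢)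

  cliqueJoinK₁∪Clique-nonadjacent : ∃₂ λ i j → i ≢ j × H i j ≡ false
  cliqueJoinK₁∪Clique-nonadjacent =
    s ↑ʳ (zero ↑ˡ t) , s ↑ʳ (1 ↑ʳ z) , (λ e → zero↑≢1↑ (↑ʳ-injective s _ _ e)) ,
    trans (+G-rr (complete s) H₂ {s ↑ʳ (zero ↑ˡ t)} {s ↑ʳ (1 ↑ʳ z)} (splitAt-↑ʳ s _ _) (splitAt-↑ʳ s _ _))
          (∪G-lr (complete 1) (complete t) {zero ↑ˡ t} {1 ↑ʳ z} (splitAt-↑ˡ 1 zero t) (splitAt-↑ʳ 1 t z))
    where
    z : Fin t
    z = fromℕ< 1≤t
    zero↑≢1↑ : zero ↑ˡ t ≢ 1 ↑ʳ z
    zero↑≢1↑ e with trans (sym (splitAt-↑ˡ 1 zero t)) (trans (cong (splitAt 1) e) (splitAt-↑ʳ 1 t z))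
    ... | ()

  blockLabel : Fin 1 ⊎ Fin t → Label
  blockLabel = [ (λ _ → middle) , (λ _ → right) ]′

  sideLabel : Fin s ⊎ Fin (1 + t) → Label
  sideLabel = [ (λ _ → left) , (λ y → blockLabel (splitAt 1 y)) ]′

  label : Fin (s + (1 + t)) → Label
  label i = sideLabel (splitAt s i)

  label-left : ∀ {p} → label p ≡ left → ∃ λ x → splitAt s p ≡ inj₁ x
  label-left {p} e with splitAt s p
  ... | inj₁ x = x , refl
  ... | inj₂ y with splitAt 1 y
  label-left () | inj₂ y | inj₁ _
  label-left () | inj₂ y | inj₂ _

  label-right : ∀ {p} → label p ≡ right → ∃₂ λ y z → splitAt s p ≡ inj₂ y × splitAt 1 y ≡ inj₂ z
  label-right {p} e with splitAt s p
  label-right () | inj₁ x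
  ... | inj₂ y with splitAt 1 y in f
  label-right () | inj₂ y | inj₁ _
  ... | inj₂ z = y , z , refl , f

  label-middle : ∀ {p} → label p ≡ middle → ∃ λ y → splitAt s p ≡ inj₂ y × ∃ λ z → splitAt 1 y ≡ inj₁ z
  label-middle {p} e with splitAt s p
  label-middle () | inj₁ x
  ... | inj₂ y with splitAt 1 y in f
  ... | inj₁ z = y , refl , z , f
  label-middle () | inj₂ y | inj₂ _

  same-end : ∀ {p q l} → l ≢ middle → label p ≡ l → label q ≡ l → TwinsOutside H p q
  same-end {l = left} _ lₚ l_q = twins-left (complete-twins s _ _) (proj₂ (label-left lₚ)) (proj₂ (label-left l_q))
  same-end {l = middle} ¬m _ _ = ⊥-elim (¬m refl)
  same-end {l = right} _ lₚ l_q with label-right lₚ | label-right l_q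
  ... | y , z , eₚ , fₚ | y′ , z′ , e_q , f_q =
    twins-right (∪G-twins-right (complete 1) (complete t) {y} {y′} (complete-twins t z z′) fₚ f_q) eₚ e_q

  unique-middle : ∀ {p q} → label p ≡ middle → label q ≡ middle → p ≡ q
  unique-middle lₚ l_q with label-middle lₚ | label-middle l_q
  ... | y , eₚ , zero , fₚ | y′ , e_q , zero , f_q =
    splitAt-injective s (trans eₚ (trans (cong inj₂ (splitAt-injective 1 (trans fₚ (sym f_q)))) (sym e_q)))

  -- Both are adjacent to every vertex other than themselves and the K₁-vertex.
  left-right : ∀ {p q r} → label p ≡ left → label q ≡ right → label r ≡ middle →
               ∀ w → w ≢ r → w ≢ p → w ≢ q → H p w ≡ H q w
  left-right {p} {q} {r} lₚ l_q lᵣ w w≢r w≢p w≢q with label-left lₚ | label-right l_q | side w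
  ... | x , eₚ | y , z , e_q , f_q | inj₁ (x′ , e_w) =
    trans (+G-ll _ _ {p} {w} eₚ e_w) (trans (complete-≢ (≢ˡ eₚ e_w w≢p ∘ sym)) (sym (+G-rl _ _ {q} {w} e_q e_w)))
  ... | x , eₚ | y , z , e_q , f_q | inj₂ (y′ , e_w) = trans (+G-lr _ _ {p} {w} eₚ e_w) (sym (trans (+G-rr _ _ {q} {w} e_q e_w) inner))
    where
    inner : H₂ y y′ ≡ true
    inner with Inner.side y′
    ... | inj₁ (zero , f_w) = ⊥-elim (w≢r (unique-middle w-middle lᵣ))
      where
      w-middle : label w ≡ middle
      w-middle = trans (cong sideLabel e_w) (cong blockLabel f_w)
    ... | inj₂ (z′ , f_w) =
      trans (∪G-rr _ _ {y} {y′} f_q f_w) (complete-≢ (Inner.≢ʳ f_q f_w (≢ʳ e_q e_w w≢q) ∘ sym))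

  cliqueJoinK₁∪Clique-NoSeparatedTriple : NoSeparatedTriple H
  cliqueJoinK₁∪Clique-NoSeparatedTriple = labelled⇒NoSeparatedTriple H label same-end unique-middle left-right

-- γ = n − 2 in diameter two

module ≅-Transfer {n m} (G : Graph n) (H : Adj m) (iso : G ≅ H) where
  f : Fin n → Fin m
  f = proj₁ iso
  f-injective : ∀ {u v} → f u ≡ f v → u ≡ v
  f-injective = proj₁ (proj₁ (proj₂ iso))
  f⁻¹ : Fin m → Fin n
  f⁻¹ y = proj₁ (proj₂ (proj₁ (proj₂ iso)) y)
  f∘f⁻¹ : ∀ y → f (f⁻¹ y) ≡ y
  f∘f⁻¹ y = proj₂ (proj₂ (proj₁ (proj₂ iso)) y) refl
  adj≡ : ∀ u v → adj G u v ≡ H (f u) (f v)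
  adj≡ = proj₂ (proj₂ iso)
  f-≢ : ∀ {u v} → u ≢ v → f u ≢ f v
  f-≢ u≢v = u≢v ∘ f-injective
  f⁻¹-≢ : ∀ {x y} → x ≢ y → f⁻¹ x ≢ f⁻¹ y
  f⁻¹-≢ x≢y e = x≢y (trans (sym (f∘f⁻¹ _)) (trans (cong f e) (f∘f⁻¹ _)))
  adj≡⁻¹ : ∀ x y → adj G (f⁻¹ x) (f⁻¹ y) ≡ H x y
  adj≡⁻¹ x y = trans (adj≡ (f⁻¹ x) (f⁻¹ y)) (cong₂ H (f∘f⁻¹ x) (f∘f⁻¹ y))

  n≤m : n ≤ m
  n≤m = injective⇒≤ f-injective

  transfer-NoSeparatedTriple : NoSeparatedTriple H → NoSeparatedTriple (adj G)
  transfer-NoSeparatedTriple noSep a b c a≢b a≢c b≢c sab sac sbc =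
    noSep (f a) (f b) (f c) (f-≢ a≢b) (f-≢ a≢c) (f-≢ b≢c) (image sab) (image sac) (image sbc)
    where
    image : ∀ {p q} → SeparatedOutside (adj G) a b c p q → SeparatedOutside H (f a) (f b) (f c) (f p) (f q)
    image {p} {q} (w , w≢a , w≢b , w≢c , differ) =
      f w , f-≢ w≢a , f-≢ w≢b , f-≢ w≢c , λ e → differ (trans (adj≡ p w) (trans e (sym (adj≡ q w))))

  transfer-Diameter≤2 : Diameter≤2 H → Diameter≤2 (adj G)
  transfer-Diameter≤2 diam u v u≢v nonadj with diam (f u) (f v) (f-≢ u≢v) (trans (sym (adj≡ u v)) nonadj)
  ... | c , uc , cv = f⁻¹ c , trans (adj≡ u (f⁻¹ c)) (trans (cong (H (f u)) (f∘f⁻¹ c)) uc)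
                            , trans (adj≡ (f⁻¹ c) v) (trans (cong (λ z → H z (f v)) (f∘f⁻¹ c)) cv)

  transfer-nonadjacent : (∃₂ λ i j → i ≢ j × H i j ≡ false) → ∃₂ λ u v → u ≢ v × adj G u v ≡ false
  transfer-nonadjacent (i , j , i≢j , nonadj) = f⁻¹ i , f⁻¹ j , f⁻¹-≢ i≢j , trans (adj≡⁻¹ i j) nonadj

module _ {n : ℕ} (G : Graph n) where

  resolving-lower-bound : Diameter≤2 (adj G) → 2 < n → NoSeparatedTriple (adj G) →
                          ∀ D → Resolving G D → n ∸ 2 ≤ ∣ D ∣
  resolving-lower-bound diam 2<n noSep D res with n ∸ 2 ≤? ∣ D ∣
  ... | yes le = le
  ... | no ≰ with three-outside D (3+ (≰⇒> ≰))
    where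
    3+ : ∀ {d n} → d < n ∸ 2 → 3 + d ≤ n
    3+ {n = suc (suc n)} d<n∸2 = s≤s (s≤s d<n∸2)
  ...   | a , b , c , a≢b , a≢c , b≢c , a∉ , b∉ , c∉ =
    ⊥-elim (noSep a b c a≢b a≢c b≢c (separated a≢b a∉ b∉) (separated a≢c a∉ c∉) (separated b≢c b∉ c∉))
    where
    open Diameter2 G diam 2<n
    separated : ∀ {p q} → p ≢ q → p ∉ D → q ∉ D → SeparatedOutside (adj G) a b c p q
    separated p≢q p∉ q∉ with res _ _ p≢q p∉ q∉
    ... | w , w∈ , differ = w , (λ { refl → a∉ w∈ }) , (λ { refl → b∉ w∈ }) , (λ { refl → c∉ w∈ }) ,
                       λ e → differ (same-adj⇒same-dist (λ { refl → p∉ w∈ }) (λ { refl → q∉ w∈ }) e)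

  -- If V ∖ {a, b, c} resolved the triple it would be a resolving dominating set of size n − 3.
  minimal⇒NoSeparatedTriple : Diameter≤2 (adj G) → 4 ≤ n → ∀ k → 2 ≤ k →
                              LowerBound G k (n ∸ 2) → NoSeparatedTriple (adj G)
  minimal⇒NoSeparatedTriple diam 4≤n k 2≤k lower a b c a≢b a≢c b≢c sab sac sbc =
    <-irrefl refl (subst (λ m → m ∸ 2 ≤ ∣ D ∣) (sym size) (lower D (resolving , dominating)))
    where
    open Diameter2 G diam (≤-trans (s≤s (s≤s (s≤s z≤n))) 4≤n)
    D : Subset n
    D = ⊤ ∖ a ∖ b ∖ c
    size : 3 + ∣ D ∣ ≡ n
    size = ∣⊤∖a∖b∖c∣ a≢b a≢c b≢c
    witness : ∀ {p q} → SeparatedOutside (adj G) a b c p q → ∃ λ w → w ∈ D × adj G p w ≢ adj G q w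
    witness (w , w≢a , w≢b , w≢c , differ) = w , ∈⊤∖a∖b∖c w≢a w≢b w≢c , differ
    flip : ∀ {p q} → SeparatedOutside (adj G) a b c p q → SeparatedOutside (adj G) a b c q p
    flip (w , w≢a , w≢b , w≢c , differ) = w , w≢a , w≢b , w≢c , differ ∘ sym
    resolving : Resolving G D
    resolving = adjacency-resolving λ u v u≢v u∉ v∉ → witness (pair (∉⊤∖a∖b∖c u∉) (∉⊤∖a∖b∖c v∉) u≢v)
      where
      pair : ∀ {u v} → u ≡ a ⊎ u ≡ b ⊎ u ≡ c → v ≡ a ⊎ v ≡ b ⊎ v ≡ c → u ≢ v → SeparatedOutside (adj G) a b c u v
      pair (inj₁ refl)        (inj₁ refl)        u≢v = ⊥-elim (u≢v refl)
      pair (inj₁ refl)        (inj₂ (inj₁ refl)) _   = sab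
      pair (inj₁ refl)        (inj₂ (inj₂ refl)) _   = sac
      pair (inj₂ (inj₁ refl)) (inj₁ refl)        _   = flip sab
      pair (inj₂ (inj₁ refl)) (inj₂ (inj₁ refl)) u≢v = ⊥-elim (u≢v refl)
      pair (inj₂ (inj₁ refl)) (inj₂ (inj₂ refl)) _   = sbc
      pair (inj₂ (inj₂ refl)) (inj₁ refl)        _   = flip sac
      pair (inj₂ (inj₂ refl)) (inj₂ (inj₁ refl)) _   = flip sbc
      pair (inj₂ (inj₂ refl)) (inj₂ (inj₂ refl)) u≢v = ⊥-elim (u≢v refl)
    dominating : DistDominating G k D
    dominating with 1≤∣p∣⇒Nonempty {p = D} (≤-pred (≤-pred (≤-pred (subst (4 ≤_) (sym size) 4≤n))))
    ... | d , d∈ = nonempty-dominating k 2≤k d∈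

  NoSeparatedTriple⇒γ≡n∸2 : ∀ k → 2 ≤ k → 4 ≤ n → Diameter≤2 (adj G) → NoSeparatedTriple (adj G) →
          (∃₂ λ u v → u ≢ v × adj G u v ≡ false) → GammaR G k (n ∸ 2)
  NoSeparatedTriple⇒γ≡n∸2 k 2≤k 4≤n diam noSep (u , v , u≢v , nonadj) with diam u v u≢v nonadj
  ... | c , uc , cv with inducedP3⇒resolvingDom G k 2≤k uc cv nonadj u≢v
  ...   | resDom , size =
    (⊤ ∖ u ∖ c , resDom , cong (_∸ 2) size) ,
    λ D rd → resolving-lower-bound diam (≤-trans (s≤s (s≤s (s≤s z≤n))) 4≤n) noSep D (proj₁ rd)

-- A single landmark

∣m-n∣≡1 : ∀ m n → m ≤ suc n → n ≤ suc m → m ≢ n → ∣ m - n ∣ ≡ 1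
∣m-n∣≡1 zero          zero          _       _        m≢n = ⊥-elim (m≢n refl)
∣m-n∣≡1 zero          (suc zero)    _       _        _   = refl
∣m-n∣≡1 zero          (suc (suc n)) _       (s≤s ()) _
∣m-n∣≡1 (suc zero)    zero          _       _        _   = refl
∣m-n∣≡1 (suc (suc m)) zero          (s≤s ()) _       _
∣m-n∣≡1 (suc m)       (suc n)       (s≤s a) (s≤s b)  m≢n = ∣m-n∣≡1 m n a b (m≢n ∘ cong suc)

∣m-n∣≡1⇒ : ∀ m n → ∣ m - n ∣ ≡ 1 → m ≡ suc n ⊎ n ≡ suc m
∣m-n∣≡1⇒ zero       (suc zero) _ = inj₂ refl
∣m-n∣≡1⇒ (suc zero) zero       _ = inj₁ refl
∣m-n∣≡1⇒ (suc m)    (suc n)    e = map (cong suc) (cong suc) (∣m-n∣≡1⇒ m n e)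

∣1+n-n∣≡1 : ∀ n → ∣ suc n - n ∣ ≡ 1
∣1+n-n∣≡1 zero    = refl
∣1+n-n∣≡1 (suc n) = ∣1+n-n∣≡1 n

≡≡ᵇ1 : ∀ {b} m → (b ≡ true → m ≡ 1) → (m ≡ 1 → b ≡ true) → b ≡ (m ≡ᵇ 1)
≡≡ᵇ1 {true}  m       ⇒ _ rewrite ⇒ refl = refl
≡≡ᵇ1 {false} zero          _ _ = refl
≡≡ᵇ1 {false} (suc zero)    _ ⇐ = ⊥-elim (true≢false (sym (⇐ refl)))
≡≡ᵇ1 {false} (suc (suc m)) _ _ = refl

injective⇒surjective : ∀ {n} (f : Fin n → Fin n) → (∀ {x y} → f x ≡ f y → x ≡ y) → ∀ y → ∃ λ x → f x ≡ y
injective⇒surjective {suc n} f f-inj y with any? (λ x → f x ≟ y)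
... | yes hit = hit
... | no miss = ⊥-elim (<-irrefl refl (injective⇒≤ {f = squeeze} squeeze-injective))
  where
  y≢f : ∀ x → y ≢ f x
  y≢f x e = miss (x , sym e)
  squeeze : Fin (suc n) → Fin n
  squeeze x = punchOut (y≢f x)
  squeeze-injective : Injective _≡_ _≡_ squeeze
  squeeze-injective {a} {b} e = f-inj (punchOut-injective (y≢f a) (y≢f b) e)

module _ {n : ℕ} (G : Graph n) where

  dominating⇒nonempty : ∀ {k D} → 1 ≤ n → DistDominating G k D → 1 ≤ ∣ D ∣
  dominating⇒nonempty {D = D} (s≤s _) dom with zero ∈? D
  ... | yes 0∈ = x∈p⇒1≤∣p∣ 0∈
  ... | no 0∉ with dom zero 0∉
  ...   | u , u∈ , _ = x∈p⇒1≤∣p∣ u∈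

  module Levels (w : Fin n) (ℓ : Fin n → ℕ) (dist≡ℓ : ∀ v → dist G v w ≡ just (ℓ v))
                (ℓ-injective : ∀ {u v} → ℓ u ≡ ℓ v → u ≡ v) where

    ℓ-reach : ∀ {j v} → reach (adj G) j v w ≡ true → ℓ v ≤ j
    ℓ-reach {j} {v} r = ≮⇒≥ λ j<ℓv → true≢false (trans (sym r) (dist-minimal G (dist≡ℓ v) j j<ℓv))

    ℓ-adjacent : ∀ {a b} → adj G a b ≡ true → ℓ a ≤ suc (ℓ b)
    ℓ-adjacent {b = b} ab = ℓ-reach (reach-cons (adj G) (ℓ b) ab (dist⇒reach G (dist≡ℓ b)))

    -- The first step from a towards w lands on the unique vertex of level ℓ b.
    ℓ≡suc⇒adj : ∀ {a b} → ℓ a ≡ suc (ℓ b) → adj G a b ≡ true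
    ℓ≡suc⇒adj {a} {b} e with dist-first-step G {a} {w} (trans (dist-sym G w a) (trans (dist≡ℓ a) (cong just e)))
    ... | c , ac , r = trans (cong (adj G a) (sym (ℓ-injective (≤-antisym c≤b b≤c)))) ac
      where
      c≤b : ℓ c ≤ ℓ b
      c≤b = ℓ-reach (reach-sym (adj G) (adj-sym G) (ℓ b) r)
      b≤c : ℓ b ≤ ℓ c
      b≤c = ≤-pred (subst (_≤ suc (ℓ c)) e (ℓ-adjacent ac))

    adj≡∣ℓ-ℓ∣≡ᵇ1 : ∀ a b → adj G a b ≡ (∣ ℓ a - ℓ b ∣ ≡ᵇ 1)
    adj≡∣ℓ-ℓ∣≡ᵇ1 a b = ≡≡ᵇ1 ∣ ℓ a - ℓ b ∣ adjacent⇒ ⇒adjacent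
      where
      adjacent⇒ : adj G a b ≡ true → ∣ ℓ a - ℓ b ∣ ≡ 1
      adjacent⇒ ab = ∣m-n∣≡1 (ℓ a) (ℓ b) (ℓ-adjacent ab) (ℓ-adjacent (adj-flip G ab)) (adj⇒≢ G ab ∘ ℓ-injective)
      ⇒adjacent : ∣ ℓ a - ℓ b ∣ ≡ 1 → adj G a b ≡ true
      ⇒adjacent e with ∣m-n∣≡1⇒ (ℓ a) (ℓ b) e
      ... | inj₁ a→b = ℓ≡suc⇒adj a→b
      ... | inj₂ b→a = adj-flip G (ℓ≡suc⇒adj b→a)

    level : Fin n → Fin n
    level v = fromℕ< (dist<n G (dist≡ℓ v))

    toℕ-level : ∀ v → toℕ (level v) ≡ ℓ v
    toℕ-level v = toℕ-fromℕ< (dist<n G (dist≡ℓ v))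

    level-injective : ∀ {u v} → level u ≡ level v → u ≡ v
    level-injective {u} {v} e = ℓ-injective (trans (sym (toℕ-level u)) (trans (cong toℕ e) (toℕ-level v)))

    levels⇒≅path : G ≅ pathG n
    levels⇒≅path =
      level ,
      (level-injective , λ y → let (x , e) = injective⇒surjective level level-injective y in x , λ { refl → e }) ,
      λ a b → trans (adj≡∣ℓ-ℓ∣≡ᵇ1 a b) (cong₂ (λ x y → ∣ x - y ∣ ≡ᵇ 1) (sym (toℕ-level a)) (sym (toℕ-level b)))

    level-max : ∀ {n′} → n ≡ suc n′ → ∃ λ v → ℓ v ≡ n′
    level-max refl with injective⇒surjective level level-injective (fromℕ _)
    ... | v , e = v , trans (sym (toℕ-level v)) (trans (cong toℕ e) (toℕ-fromℕ _))

  single-landmark⇒path : ∀ k D → ResolvingDom G k D → ∣ D ∣ ≡ 1 → n ≤ k + 1 × G ≅ pathG n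
  single-landmark⇒path k D (res , dom) size with ∣p∣≡1⇒singleton size
  ... | w , w∈ , only = n≤k+1 , Levels.levels⇒≅path w ℓ dist≡ℓ ℓ-injective
    where
    ∉D : ∀ {v} → v ≢ w → v ∉ D
    ∉D v≢w v∈ = v≢w (only _ v∈)
    within-k : ∀ v → ∃ λ m → dist G v w ≡ just m × m ≤ k
    within-k v with v ≟ w
    ... | yes refl = 0 , dist-refl G v , z≤n
    ... | no v≢w with dom v (∉D v≢w)
    ...   | u , u∈ , m , e , m≤k rewrite only u u∈ = m , trans (dist-sym G v w) e , m≤k
    ℓ : Fin n → ℕ
    ℓ v = proj₁ (within-k v)
    dist≡ℓ : ∀ v → dist G v w ≡ just (ℓ v)
    dist≡ℓ v = proj₁ (proj₂ (within-k v))
    ℓ≡0⇒≡w : ∀ {v} → ℓ v ≡ 0 → v ≡ w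
    ℓ≡0⇒≡w {v} e = dist≡0⇒≡ G (trans (dist≡ℓ v) (cong just e))
    ℓw≡0 : ℓ w ≡ 0
    ℓw≡0 = just-injective (trans (sym (dist≡ℓ w)) (dist-refl G w))
    ℓ-injective : ∀ {u v} → ℓ u ≡ ℓ v → u ≡ v
    ℓ-injective {u} {v} e with u ≟ v
    ... | yes u≡v = u≡v
    ... | no u≢v = cases (u ≟ w) (v ≟ w)
      where
      cases : Dec (u ≡ w) → Dec (v ≡ w) → u ≡ v
      cases (yes refl) _ = sym (ℓ≡0⇒≡w (trans (sym e) ℓw≡0))
      cases (no _) (yes refl) = ℓ≡0⇒≡w (trans e ℓw≡0)
      cases (no u≢w) (no v≢w) with res u v u≢v (∉D u≢w) (∉D v≢w)
      ... | w′ , w′∈ , differ rewrite only w′ w′∈ = ⊥-elim (differ (trans (dist≡ℓ u) (trans (cong just e) (sym (dist≡ℓ v)))))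
    n≤k+1 : n ≤ k + 1
    n≤k+1 with fin⇒suc w
      where
      fin⇒suc : ∀ {n} → Fin n → ∃ λ n′ → n ≡ suc n′
      fin⇒suc {suc n′} _ = n′ , refl
    ... | n′ , n≡1+n′ with Levels.level-max w ℓ dist≡ℓ ℓ-injective n≡1+n′
    ...   | v , ℓv≡n′ =
      subst (_≤ k + 1) (trans (cong suc ℓv≡n′) (sym n≡1+n′))
            (subst (suc (ℓ v) ≤_) (+-comm 1 k) (s≤s (proj₂ (proj₂ (within-k v)))))

  module OnPath {m} (iso : G ≅ pathG m) (1≤m : 1 ≤ m) where
    open ≅-Transfer G (pathG m) iso

    position : Fin n → ℕ
    position v = toℕ (f v)

    position-injective : ∀ {u v} → position u ≡ position v → u ≡ v
    position-injective e = f-injective (toℕ-injective e)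

    n≡m : n ≡ m
    n≡m = ≤-antisym n≤m (injective⇒≤ f⁻¹-injective)
      where
      f⁻¹-injective : ∀ {x y} → f⁻¹ x ≡ f⁻¹ y → x ≡ y
      f⁻¹-injective {x} {y} e = trans (sym (f∘f⁻¹ x)) (trans (cong f e) (f∘f⁻¹ y))

    endpoint : Fin n
    endpoint = f⁻¹ (fromℕ< 1≤m)

    position-endpoint : position endpoint ≡ 0
    position-endpoint = trans (cong toℕ (f∘f⁻¹ _)) (toℕ-fromℕ< 1≤m)

    adj⇒∣Δ∣≡1 : ∀ {a b} → adj G a b ≡ true → ∣ position a - position b ∣ ≡ 1
    adj⇒∣Δ∣≡1 {a} {b} ab = ≡ᵇ⇒≡ _ _ (subst T (trans (sym ab) (adj≡ a b)) tt)

    reach⇒∣Δ∣≤ : ∀ j {u v} → reach (adj G) j u v ≡ true → ∣ position u - position v ∣ ≤ j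
    reach⇒∣Δ∣≤ zero {v = v} r rewrite reach₀⇒≡ (adj G) r = ≤-reflexive (∣n-n∣≡0 (position v))
    reach⇒∣Δ∣≤ (suc j) {u} {v} r with reach-suc⁻ (adj G) j r
    ... | inj₁ r′ = m≤n⇒m≤1+n (reach⇒∣Δ∣≤ j r′)
    ... | inj₂ (c , rc , cv) = begin
      ∣ position u - position v ∣                           ≤⟨ ∣-∣-triangle (position u) (position c) (position v) ⟩
      ∣ position u - position c ∣ + ∣ position c - position v ∣ ≡⟨ cong (∣ position u - position c ∣ +_) (adj⇒∣Δ∣≡1 cv) ⟩
      ∣ position u - position c ∣ + 1                       ≤⟨ +-mono-≤ (reach⇒∣Δ∣≤ j rc) ≤-refl ⟩
      j + 1                                                 ≡⟨ +-comm j 1 ⟩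
      suc j                                                 ∎
      where open ≤-Reasoning

    walk-to-endpoint : ∀ i v → position v ≡ i → reach (adj G) i v endpoint ≡ true
    walk-to-endpoint zero v e =
      subst (λ z → reach (adj G) 0 v z ≡ true) (position-injective (trans e (sym position-endpoint))) (reach-refl (adj G) v)
    walk-to-endpoint (suc i) v e = reach-cons (adj G) i step (walk-to-endpoint i v′ position-v′)
      where
      i<m : i < m
      i<m = <⇒≤ (subst (_< m) e (toℕ<n (f v)))
      v′ : Fin n
      v′ = f⁻¹ (fromℕ< i<m)
      position-v′ : position v′ ≡ i
      position-v′ = trans (cong toℕ (f∘f⁻¹ (fromℕ< i<m))) (toℕ-fromℕ< i<m)
      step : adj G v v′ ≡ true
      step = trans (adj≡ v v′) (cong (_≡ᵇ 1) (trans (cong₂ ∣_-_∣ e position-v′) (∣1+n-n∣≡1 i)))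

    dist-to-endpoint : ∀ v → dist G v endpoint ≡ just (position v)
    dist-to-endpoint v = reach⇒dist≡ G (walk-to-endpoint (position v) v refl) shorter
                                     (subst (position v <_) (sym n≡m) (toℕ<n (f v)))
      where
      shorter : ∀ j → j < position v → reach (adj G) j v endpoint ≡ false
      shorter j j< = ≢true⇒≡false λ r → <-irrefl refl (<-≤-trans j<
        (subst (_≤ j) (trans (cong (λ z → ∣ position v - z ∣) position-endpoint) (∣-∣-identityʳ (position v)))
               (reach⇒∣Δ∣≤ j r)))

    endpoint-resolvingDom : ∀ k → m ≤ k + 1 → ResolvingDom G k ⁅ endpoint ⁆
    endpoint-resolvingDom k m≤k+1 = resolving , dominating
      where
      resolving : Resolving G ⁅ endpoint ⁆
      resolving u v u≢v _ _ = endpoint , x∈⁅x⁆ endpoint ,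
        λ e → u≢v (position-injective (just-injective (trans (sym (dist-to-endpoint u)) (trans e (dist-to-endpoint v)))))
      dominating : DistDominating G k ⁅ endpoint ⁆
      dominating v _ = endpoint , x∈⁅x⁆ endpoint , position v , trans (dist-sym G endpoint v) (dist-to-endpoint v) ,
                       ≤-pred (≤-trans (toℕ<n (f v)) (subst (m ≤_) (+-comm k 1) m≤k+1))

-- Diameter two without separated triples

module _ {n : ℕ} (G : Graph n) where

  InducedK₁∪K₂ : Fin n → Fin n → Fin n → Set
  InducedK₁∪K₂ x y z = adj G x y ≡ false × adj G y z ≡ false × adj G x z ≡ true × x ≢ y × y ≢ z

  module CompleteMultipartite (noK₁∪K₂ : ∀ x y z → InducedK₁∪K₂ x y z → ⊥) where

    nonadjacent-trans : ∀ {p q r} → p ≢ r → adj G p q ≡ false → adj G q r ≡ false → adj G p r ≡ false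
    nonadjacent-trans {p} {q} {r} p≢r pq qr with p ≟ q | q ≟ r
    ... | yes refl | _ = qr
    ... | no _ | yes refl = pq
    ... | no p≢q | no q≢r = ≢true⇒≡false λ pr → noK₁∪K₂ p q r (pq , qr , pr , p≢q , q≢r)

    module _ {x₀ y₀ w₀ : Fin n} (x₀≢y₀ : x₀ ≢ y₀) (x₀y₀ : adj G x₀ y₀ ≡ false) (x₀w₀ : adj G x₀ w₀ ≡ true) where

      non-neighbours-independent : ∀ {u v} → adj G x₀ u ≡ false → adj G x₀ v ≡ false → u ≢ v → adj G u v ≡ false
      non-neighbours-independent {u} {v} x₀u x₀v u≢v with u ≟ x₀ | v ≟ x₀
      ... | yes refl | _ = x₀v
      ... | no _ | yes refl = adj-flip G x₀u
      ... | no _ | no _ = nonadjacent-trans u≢v (adj-flip G x₀u) x₀v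

      non-neighbour-neighbour : ∀ {u v} → adj G x₀ u ≡ false → adj G x₀ v ≡ true → adj G u v ≡ true
      non-neighbour-neighbour {u} {v} x₀u x₀v with u ≟ x₀
      ... | yes refl = x₀v
      ... | no _ = ≢false⇒≡true λ uv → true≢false (trans (sym x₀v) (nonadjacent-trans (adj⇒≢ G x₀v) x₀u uv))

      independent-neighbourhood⇒completeBip : (∀ u v → adj G x₀ u ≡ true → adj G x₀ v ≡ true → adj G u v ≡ false) →
                                              ∃₂ λ s t → 1 ≤ s × 1 ≤ t × G ≅ completeBip s t
      independent-neighbourhood⇒completeBip independent =
        s , t , fin⇒1≤ (proj₁ (to-true x₀ (cong not (irrefl G x₀)))) , fin⇒1≤ (proj₁ (to-false w₀ (cong not x₀w₀))) ,
        partition⇒≅ G (completeBip s t) (partition-join (adj G) ll rr lr rl)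
        where
        open PartitionProperties (partition (not ∘ adj G x₀))
        ll : ∀ {u v i j} → to u ≡ inj₁ i → to v ≡ inj₁ j → adj G u v ≡ emptyG s i j
        ll {i = i} {j} eᵤ eᵥ = ≡emptyG G {i = i} {j}
          (non-neighbours-independent (not≡true⇒≡false (inj₁⇒true eᵤ)) (not≡true⇒≡false (inj₁⇒true eᵥ)))
        rr : ∀ {u v i j} → to u ≡ inj₂ i → to v ≡ inj₂ j → adj G u v ≡ emptyG t i j
        rr {u} {v} {i} {j} eᵤ eᵥ = ≡emptyG G {i = i} {j} λ _ →
          independent u v (not≡false⇒≡true (inj₂⇒false eᵤ)) (not≡false⇒≡true (inj₂⇒false eᵥ))
        lr : ∀ {u v i j} → to u ≡ inj₁ i → to v ≡ inj₂ j → adj G u v ≡ true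
        lr eᵤ eᵥ = non-neighbour-neighbour (not≡true⇒≡false (inj₁⇒true eᵤ)) (not≡false⇒≡true (inj₂⇒false eᵥ))
        rl : ∀ {u v i j} → to u ≡ inj₂ i → to v ≡ inj₁ j → adj G u v ≡ true
        rl {u} {v} eᵤ eᵥ = adj-flip G (lr eᵥ eᵤ)

      -- If p and q are non-adjacent neighbours of x₀ and w a common neighbour of x₀ and p, then in the triple
      -- x₀, p, w the pairs x₀p and x₀w are separated by y₀ and the pair pw by q.
      neighbourhood-clique : NoSeparatedTriple (adj G) → ∀ {u₁ v₁} → adj G x₀ u₁ ≡ true → adj G x₀ v₁ ≡ true →
                             adj G u₁ v₁ ≡ true → ∀ p q → adj G x₀ p ≡ true → adj G x₀ q ≡ true → p ≢ q →
                             adj G p q ≡ true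
      neighbourhood-clique noSep {u₁} {v₁} x₀u₁ x₀v₁ u₁v₁ p q x₀p x₀q p≢q =
        ≢false⇒≡true λ pq → let (w , x₀w , pw) = common-neighbour in separated x₀w pw pq
        where
        common-neighbour : ∃ λ w → adj G x₀ w ≡ true × adj G p w ≡ true
        common-neighbour with adj G p u₁ in pu₁ | adj G p v₁ in pv₁
        ... | true | _ = u₁ , x₀u₁ , pu₁
        ... | false | true = v₁ , x₀v₁ , pv₁
        ... | false | false = ⊥-elim (true≢false (trans (sym u₁v₁)
                                (nonadjacent-trans (adj⇒≢ G u₁v₁) (adj-flip G pu₁) pv₁)))
        separated : ∀ {w} → adj G x₀ w ≡ true → adj G p w ≡ true → adj G p q ≡ false → ⊥
        separated {w} x₀w pw pq =
          noSep x₀ p w (adj⇒≢ G x₀p) (adj⇒≢ G x₀w) (adj⇒≢ G pw) (y₀-separates x₀p) (y₀-separates x₀w)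
            (q , adj⇒≢ G x₀q ∘ sym , p≢q ∘ sym , adj≢nonadj G pw pq ∘ sym , λ e → true≢false (trans (sym wq) (trans (sym e) pq)))
          where
          y₀-separates : ∀ {z} → adj G x₀ z ≡ true → SeparatedOutside (adj G) x₀ p w x₀ z
          y₀-separates {z} x₀z =
            y₀ , x₀≢y₀ ∘ sym , adj≢nonadj G x₀p x₀y₀ ∘ sym , adj≢nonadj G x₀w x₀y₀ ∘ sym ,
            λ e → true≢false (trans (sym (adj-flip G (non-neighbour-neighbour x₀y₀ x₀z))) (trans (sym e) x₀y₀))
          wq : adj G w q ≡ true
          wq = ≢false⇒≡true λ wq → true≢false (trans (sym pw) (nonadjacent-trans (adj⇒≢ G pw) pq (adj-flip G wq)))

      neighbourhood-edge⇒cliqueJoinIndependent : NoSeparatedTriple (adj G) → ∀ {u₁ v₁} → adj G x₀ u₁ ≡ true →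
        adj G x₀ v₁ ≡ true → adj G u₁ v₁ ≡ true → ∃₂ λ s t → 1 ≤ s × 2 ≤ t × G ≅ (complete s +G emptyG t)
      neighbourhood-edge⇒cliqueJoinIndependent noSep {u₁} x₀u₁ x₀v₁ u₁v₁ =
        s , t , fin⇒1≤ (proj₁ (to-true u₁ x₀u₁)) , 2≤t , partition⇒≅ G (complete s +G emptyG t) (partition-join (adj G) ll rr lr rl)
        where
        open PartitionProperties (partition (adj G x₀))
        2≤t : 2 ≤ t
        2≤t with to-false x₀ (irrefl G x₀) | to-false y₀ x₀y₀
        ... | i , eₓ | j , e_y = ≢⇒2≤ {u = i} {j} λ { refl → x₀≢y₀ (to-injective (trans eₓ (sym e_y))) }
        ll : ∀ {u v i j} → to u ≡ inj₁ i → to v ≡ inj₁ j → adj G u v ≡ complete s i j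
        ll {u} {v} eᵤ eᵥ = ≡complete G (proj₁ (same-block₁ eᵤ eᵥ)) (proj₂ (same-block₁ eᵤ eᵥ))
                             (neighbourhood-clique noSep x₀u₁ x₀v₁ u₁v₁ u v (inj₁⇒true eᵤ) (inj₁⇒true eᵥ))
        rr : ∀ {u v i j} → to u ≡ inj₂ i → to v ≡ inj₂ j → adj G u v ≡ emptyG t i j
        rr {i = i} {j} eᵤ eᵥ = ≡emptyG G {i = i} {j} (non-neighbours-independent (inj₂⇒false eᵤ) (inj₂⇒false eᵥ))
        rl : ∀ {u v i j} → to u ≡ inj₂ i → to v ≡ inj₁ j → adj G u v ≡ true
        rl eᵤ eᵥ = non-neighbour-neighbour (inj₂⇒false eᵤ) (inj₁⇒true eᵥ)
        lr : ∀ {u v i j} → to u ≡ inj₁ i → to v ≡ inj₂ j → adj G u v ≡ true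
        lr {u} {v} eᵤ eᵥ = adj-flip G (rl eᵥ eᵤ)

-- In each configuration used below, vertex 0 is y and vertices 1 and 2 are adjacent non-neighbours of y.
module WithInducedK₁∪K₂ {n : ℕ} (G : Graph n) (noSep : NoSeparatedTriple (adj G)) (diam : Diameter≤2 (adj G))
  {x y z w₀ : Fin n} (xy : adj G x y ≡ false) (yz : adj G y z ≡ false) (xz : adj G x z ≡ true) (x≢y : x ≢ y) (y≢z : y ≢ z)
  (yw₀ : adj G y w₀ ≡ true) where

  infix 6 _~_
  _~_ : Fin n → Fin n → Bool
  _~_ = adj G

  yx : y ~ x ≡ false
  yx = adj-flip G xy

  neighbour-adjacent-to-edge : ∀ {a b} → y ~ a ≡ false → y ~ b ≡ false → a ~ b ≡ true → y ≢ a → y ≢ b →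
                               ∀ w → y ~ w ≡ true → w ~ a ≡ true
  neighbour-adjacent-to-edge {a} {b} ya yb ab y≢a y≢b w yw with w ~ a in wa
  ... | true = refl
  ... | false with diam w a (adj≢nonadj G yw ya) wa | b ~ w in bw
  ...   | c , wc , ca | true with diam a y (y≢a ∘ sym) (adj-flip G ya)
  ...     | c′ , ac′ , c′y = ⊥-elim (unrealisable G noSep neighbour-config₁ neighbour-config₁-unrealisable
      (y ∷ a ∷ b ∷ w ∷ c′ ∷ [])
      ((y≢a ∷ y≢b ∷ adj⇒≢ G yw ∷ adj⇒≢ G (adj-flip G c′y) ∷ []) ∷
       (adj⇒≢ G ab ∷ nonadj≢adj G ya yw ∷ adj⇒≢ G ac′ ∷ []) ∷
       (nonadj≢adj G yb yw ∷ nonadj≢adj G yb (adj-flip G c′y) ∷ []) ∷ (nonadj≢adj G (adj-flip G wa) ac′ ∷ []) ∷ [] ∷ [])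
      (ya ∷ yb ∷ ab ∷ yw ∷ adj-flip G wa ∷ bw ∷ ac′ ∷ adj-flip G c′y ∷ []))
  neighbour-adjacent-to-edge {a} {b} ya yb ab y≢a y≢b w yw | false | c , wc , ca | false =
    ⊥-elim (unrealisable G noSep neighbour-config₂ neighbour-config₂-unrealisable
      (y ∷ a ∷ b ∷ w ∷ c ∷ [])
      ((y≢a ∷ y≢b ∷ adj⇒≢ G yw ∷ nonadj≢adj G (adj-flip G ya) (adj-flip G ca) ∷ []) ∷
       (adj⇒≢ G ab ∷ nonadj≢adj G ya yw ∷ adj⇒≢ G (adj-flip G ca) ∷ []) ∷
       (nonadj≢adj G yb yw ∷ nonadj≢adj G (adj-flip G bw) wc ∷ []) ∷ (adj⇒≢ G wc ∷ []) ∷ [] ∷ [])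
      (ya ∷ yb ∷ ab ∷ yw ∷ adj-flip G wa ∷ bw ∷ wc ∷ adj-flip G ca ∷ []))

  neighbour-universal : ∀ w → y ~ w ≡ true → ∀ v → w ≢ v → w ~ v ≡ true
  neighbour-universal w yw v w≢v with v ≟ y
  ... | yes refl = adj-flip G yw
  ... | no v≢y with w ~ v in wv
  ...   | true = refl
  ...   | false = ⊥-elim (unrealisable G noSep universal-config universal-config-unrealisable
      (y ∷ x ∷ z ∷ w ∷ v ∷ [])
      ((x≢y ∘ sym ∷ y≢z ∷ adj⇒≢ G yw ∷ v≢y ∘ sym ∷ []) ∷
       (adj⇒≢ G xz ∷ nonadj≢adj G yx yw ∷ adj≢nonadj G wx wv ∷ []) ∷
       (nonadj≢adj G yz yw ∷ adj≢nonadj G wz wv ∷ []) ∷ (w≢v ∷ []) ∷ [] ∷ [])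
      (yx ∷ yz ∷ xz ∷ yw ∷ adj-flip G wx ∷ adj-flip G wz ∷ wv ∷ []))
    where
    wx : w ~ x ≡ true
    wx = neighbour-adjacent-to-edge yx yz xz (x≢y ∘ sym) y≢z w yw
    wz : w ~ z ≡ true
    wz = neighbour-adjacent-to-edge yz yx (adj-flip G xz) y≢z (x≢y ∘ sym) w yw

  w₀-universal : ∀ v → y ~ v ≡ false → v ~ w₀ ≡ true
  w₀-universal v yv = adj-flip G (neighbour-universal w₀ yw₀ v (nonadj≢adj G yv yw₀ ∘ sym))

  edge-end-adjacent : ∀ {a b} → y ~ a ≡ false → y ~ b ≡ false → a ~ b ≡ true → y ≢ a → y ≢ b →
                      ∀ v → v ≢ y → v ≢ a → v ≢ b → y ~ v ≡ false → a ~ v ≡ true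
  edge-end-adjacent {a} {b} ya yb ab y≢a y≢b v v≢y v≢a v≢b yv = ≢false⇒≡true λ av →
    unrealisable G noSep clique-config₁ clique-config₁-unrealisable
      (y ∷ a ∷ b ∷ v ∷ w₀ ∷ [])
      ((y≢a ∷ y≢b ∷ v≢y ∘ sym ∷ adj⇒≢ G yw₀ ∷ []) ∷ (adj⇒≢ G ab ∷ v≢a ∘ sym ∷ nonadj≢adj G ya yw₀ ∷ []) ∷
       (v≢b ∘ sym ∷ nonadj≢adj G yb yw₀ ∷ []) ∷ (nonadj≢adj G yv yw₀ ∷ []) ∷ [] ∷ [])
      (ya ∷ yb ∷ ab ∷ yv ∷ av ∷ yw₀ ∷ w₀-universal a ya ∷ w₀-universal b yb ∷ w₀-universal v yv ∷ [])

  non-neighbours-clique : ∀ u v → u ≢ v → u ≢ y → v ≢ y → y ~ u ≡ false → y ~ v ≡ false → u ~ v ≡ true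
  non-neighbours-clique u v u≢v u≢y v≢y yu yv with u ≟ x | u ≟ z | v ≟ x | v ≟ z
  ... | yes refl | _        | yes refl | _        = ⊥-elim (u≢v refl)
  ... | yes refl | _        | no _     | yes refl = xz
  ... | yes refl | _        | no v≢x   | no v≢z   = edge-end-adjacent yx yz xz (x≢y ∘ sym) y≢z v v≢y v≢x v≢z yv
  ... | no _     | yes refl | yes refl | _        = adj-flip G xz
  ... | no _     | yes refl | no _     | yes refl = ⊥-elim (u≢v refl)
  ... | no _     | yes refl | no v≢x   | no v≢z   = edge-end-adjacent yz yx (adj-flip G xz) y≢z (x≢y ∘ sym) v v≢y v≢z v≢x yv
  ... | no u≢x   | no u≢z   | yes refl | _        = adj-flip G (edge-end-adjacent yx yz xz (x≢y ∘ sym) y≢z u u≢y u≢x u≢z yu)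
  ... | no u≢x   | no u≢z   | no _     | yes refl =
    adj-flip G (edge-end-adjacent yz yx (adj-flip G xz) y≢z (x≢y ∘ sym) u u≢y u≢z u≢x yu)
  ... | no u≢x   | no u≢z   | no v≢x   | no v≢z   = ≢false⇒≡true λ uv →
    unrealisable G noSep clique-config₂ clique-config₂-unrealisable
      (y ∷ x ∷ z ∷ u ∷ v ∷ w₀ ∷ [])
      ((x≢y ∘ sym ∷ y≢z ∷ u≢y ∘ sym ∷ v≢y ∘ sym ∷ adj⇒≢ G yw₀ ∷ []) ∷
       (adj⇒≢ G xz ∷ u≢x ∘ sym ∷ v≢x ∘ sym ∷ nonadj≢adj G yx yw₀ ∷ []) ∷
       (u≢z ∘ sym ∷ v≢z ∘ sym ∷ nonadj≢adj G yz yw₀ ∷ []) ∷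
       (u≢v ∷ nonadj≢adj G yu yw₀ ∷ []) ∷ (nonadj≢adj G yv yw₀ ∷ []) ∷ [] ∷ [])
      (yx ∷ yz ∷ xz ∷ yu ∷ yv ∷ uv ∷ yw₀ ∷
       w₀-universal x yx ∷ w₀-universal z yz ∷ w₀-universal u yu ∷ w₀-universal v yv ∷ [])

  -- Neighbours of y form the K_s block; among the non-neighbours, y is the K₁ and the rest the K_t.
  module Blocks where
    P₁ : Partition (adj G y)
    P₁ = partition (adj G y)
    module P₁ = PartitionProperties P₁
    vertex : Fin P₁.t → Fin n
    vertex j = P₁.from (inj₂ j)
    vertex-injective : ∀ {j j′} → vertex j ≡ vertex j′ → j ≡ j′
    vertex-injective e = inj₂-injective (P₁.from-injective e)
    y-vertex : ∀ j → y ~ vertex j ≡ false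
    y-vertex j = P₁.inj₂⇒false (P₁.to-from (inj₂ j))
    module P₂ = PartitionProperties (partition (λ j → ⌊ vertex j ≟ y ⌋))
    module P₃ = PartitionProperties (relabelʳ P₁ P₂.encode P₂.decode P₂.decode-encode P₂.encode-decode)
    s c t : ℕ
    s = P₁.s
    c = P₂.s
    t = P₂.t
    isY : ∀ {j} → ⌊ vertex j ≟ y ⌋ ≡ true → vertex j ≡ y
    isY {j} = ⌊⌋≡true⇒ (vertex j ≟ y)
    notY : ∀ {j} → ⌊ vertex j ≟ y ⌋ ≡ false → vertex j ≢ y
    notY {j} = ⌊⌋≡false⇒¬ (vertex j ≟ y)
    index : ∀ {u} → y ~ u ≡ false → ∃ λ j → vertex j ≡ u
    index {u} yu = let (j , e) = P₁.to-false u yu in j , trans (cong P₁.from (sym e)) (P₁.from-to u)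
    y-index : Fin c
    y-index with index (irrefl G y)
    ... | j , vj≡y = proj₁ (P₂.to-true j (⌊⌋-true (vertex j ≟ y) vj≡y))
    x-index : Fin t
    x-index with index yx
    ... | j , vj≡x = proj₁ (P₂.to-false j (⌊⌋-false (vertex j ≟ y) (x≢y ∘ trans (sym vj≡x))))
    c≡1 : c ≡ 1
    c≡1 = ≤-antisym (all-equal⇒≤1 λ i i′ →
                       inj₁-injective (P₂.from-injective (vertex-injective (trans (is-y i) (sym (is-y i′))))))
                    (fin⇒1≤ y-index)
      where
      is-y : ∀ i → vertex (P₂.from (inj₁ i)) ≡ y
      is-y i = isY (P₂.inj₁⇒true (P₂.to-from (inj₁ i)))
      all-equal⇒≤1 : ∀ {c} → (∀ (i j : Fin c) → i ≡ j) → c ≤ 1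
      all-equal⇒≤1 {zero} _ = z≤n
      all-equal⇒≤1 {suc zero} _ = s≤s z≤n
      all-equal⇒≤1 {suc (suc c)} h with h zero (suc zero)
      ... | ()
    inner : ∀ j j′ → vertex j ~ vertex j′ ≡ (complete c ∪G complete t) (P₂.encode j) (P₂.encode j′)
    inner = P₂.partition-union (λ j j′ → vertex j ~ vertex j′) ll rr lr rl
      where
      ll : ∀ {j j′ i i′} → P₂.to j ≡ inj₁ i → P₂.to j′ ≡ inj₁ i′ → vertex j ~ vertex j′ ≡ complete c i i′
      ll eⱼ eⱼ′ =
        ≡complete G (cong vertex ∘ proj₁ (P₂.same-block₁ eⱼ eⱼ′)) (proj₂ (P₂.same-block₁ eⱼ eⱼ′) ∘ vertex-injective)
                    λ ne → ⊥-elim (ne (trans (isY (P₂.inj₁⇒true eⱼ)) (sym (isY (P₂.inj₁⇒true eⱼ′)))))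
      rr : ∀ {j j′ i i′} → P₂.to j ≡ inj₂ i → P₂.to j′ ≡ inj₂ i′ → vertex j ~ vertex j′ ≡ complete t i i′
      rr {j} {j′} eⱼ eⱼ′ =
        ≡complete G (cong vertex ∘ proj₁ (P₂.same-block₂ eⱼ eⱼ′)) (proj₂ (P₂.same-block₂ eⱼ eⱼ′) ∘ vertex-injective)
          λ ne → non-neighbours-clique (vertex j) (vertex j′) ne (notY (P₂.inj₂⇒false eⱼ)) (notY (P₂.inj₂⇒false eⱼ′))
                                       (y-vertex j) (y-vertex j′)
      lr : ∀ {j j′ i i′} → P₂.to j ≡ inj₁ i → P₂.to j′ ≡ inj₂ i′ → vertex j ~ vertex j′ ≡ false
      lr {j} {j′} eⱼ _ = subst (λ u → u ~ vertex j′ ≡ false) (sym (isY (P₂.inj₁⇒true eⱼ))) (y-vertex j′)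
      rl : ∀ {j j′ i i′} → P₂.to j ≡ inj₂ i → P₂.to j′ ≡ inj₁ i′ → vertex j ~ vertex j′ ≡ false
      rl eⱼ eⱼ′ = adj-flip G (lr eⱼ′ eⱼ)
    outer : ∀ u v → u ~ v ≡ (complete s +G (complete c ∪G complete t)) (P₃.encode u) (P₃.encode v)
    outer = P₃.partition-join (adj G) ll rr lr rl
      where
      ll : ∀ {u v i i′} → P₃.to u ≡ inj₁ i → P₃.to v ≡ inj₁ i′ → u ~ v ≡ complete s i i′
      ll {u} {v} eᵤ eᵥ = ≡complete G (proj₁ (P₃.same-block₁ eᵤ eᵥ)) (proj₂ (P₃.same-block₁ eᵤ eᵥ))
                                     (neighbour-universal u (P₃.inj₁⇒true eᵤ) v)
      lr : ∀ {u v i i′} → P₃.to u ≡ inj₁ i → P₃.to v ≡ inj₂ i′ → u ~ v ≡ true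
      lr {u} {v} eᵤ eᵥ = neighbour-universal u (P₃.inj₁⇒true eᵤ) v (adj≢nonadj G (P₃.inj₁⇒true eᵤ) (P₃.inj₂⇒false eᵥ))
      rl : ∀ {u v i i′} → P₃.to u ≡ inj₂ i → P₃.to v ≡ inj₁ i′ → u ~ v ≡ true
      rl eᵤ eᵥ = adj-flip G (lr eᵥ eᵤ)
      vertex-decode : ∀ {u k} → P₃.to u ≡ inj₂ k → vertex (P₂.decode k) ≡ u
      vertex-decode {u} e = trans (cong P₁.from (sym (map₂-inj₂⁻ P₂.decode-encode e))) (P₁.from-to u)
      rr : ∀ {u v k k′} → P₃.to u ≡ inj₂ k → P₃.to v ≡ inj₂ k′ → u ~ v ≡ (complete c ∪G complete t) k k′
      rr {u} {v} {k} {k′} eᵤ eᵥ = begin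
        u ~ v                                          ≡⟨ cong₂ _~_ (sym (vertex-decode eᵤ)) (sym (vertex-decode eᵥ)) ⟩
        vertex (P₂.decode k) ~ vertex (P₂.decode k′)   ≡⟨ inner (P₂.decode k) (P₂.decode k′) ⟩
        (complete c ∪G complete t) (P₂.encode (P₂.decode k)) (P₂.encode (P₂.decode k′))
                                                       ≡⟨ cong₂ (complete c ∪G complete t) (P₂.encode-decode k) (P₂.encode-decode k′) ⟩
        (complete c ∪G complete t) k k′                ∎
        where open ≡-Reasoning

  ≅cliqueJoinK₁∪Clique : ∃₂ λ s t → 1 ≤ s × 1 ≤ t × G ≅ (complete s +G (complete 1 ∪G complete t))
  ≅cliqueJoinK₁∪Clique = s , t , fin⇒1≤ (proj₁ (P₁.to-true w₀ yw₀)) , fin⇒1≤ x-index ,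
    subst (λ c → G ≅ (complete s +G (complete c ∪G complete t))) c≡1
          (P₃.partition⇒≅ G (complete s +G (complete c ∪G complete t)) outer)
    where open Blocks

ExceptionalFamily : ∀ {n} → Graph n → Set
ExceptionalFamily G =
    (∃₂ λ s t → 1 ≤ s × 1 ≤ t × G ≅ completeBip s t)
  ⊎ (∃₂ λ s t → 1 ≤ s × 2 ≤ t × G ≅ (complete s +G emptyG t))
  ⊎ (∃₂ λ s t → 1 ≤ s × 1 ≤ t × G ≅ (complete s +G (complete 1 ∪G complete t)))

module _ {n : ℕ} (G : Graph n) where

  diameter≤2⇒neighbour : Diameter≤2 (adj G) → 2 ≤ n → ∀ u → ∃ λ w → adj G u w ≡ true
  diameter≤2⇒neighbour diam 2≤n u with another 2≤n u
  ... | v , u≢v with adj G u v in uv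
  ...   | true = v , uv
  ...   | false = let (c , uc , _) = diam u v u≢v uv in c , uc

  inducedK₁∪K₂? : ∀ x y z → Dec (InducedK₁∪K₂ G x y z)
  inducedK₁∪K₂? x y z =
    (adj G x y ≟ᵇ false) ×-dec (adj G y z ≟ᵇ false) ×-dec (adj G x z ≟ᵇ true) ×-dec ¬? (x ≟ y) ×-dec ¬? (y ≟ z)

  classification : NoSeparatedTriple (adj G) → Diameter≤2 (adj G) → 2 ≤ n →
                   ∀ x₀ y₀ → x₀ ≢ y₀ → adj G x₀ y₀ ≡ false → ExceptionalFamily G
  classification noSep diam 2≤n x₀ y₀ x₀≢y₀ x₀y₀
    with any? (λ x → any? (λ y → any? (λ z → inducedK₁∪K₂? x y z)))
  ... | yes (x , y , z , xy , yz , xz , x≢y , y≢z) =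
    inj₂ (inj₂ (WithInducedK₁∪K₂.≅cliqueJoinK₁∪Clique G noSep diam xy yz xz x≢y y≢z
                  (proj₂ (diameter≤2⇒neighbour diam 2≤n y))))
  ... | no none with any? (λ u → any? (λ v → (adj G x₀ u ≟ᵇ true) ×-dec (adj G x₀ v ≟ᵇ true) ×-dec (adj G u v ≟ᵇ true)))
  ...   | yes (u , v , x₀u , x₀v , uv) =
    inj₂ (inj₁ (neighbourhood-edge⇒cliqueJoinIndependent x₀≢y₀ x₀y₀ x₀w₀ noSep x₀u x₀v uv))
    where
    open CompleteMultipartite G (λ x y z K₁∪K₂ → none (x , y , z , K₁∪K₂))
    x₀w₀ : adj G x₀ (proj₁ (diameter≤2⇒neighbour diam 2≤n x₀)) ≡ true
    x₀w₀ = proj₂ (diameter≤2⇒neighbour diam 2≤n x₀)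
  ...   | no no-edge = inj₁ (independent-neighbourhood⇒completeBip x₀≢y₀ x₀y₀ x₀w₀
                              λ u v x₀u x₀v → ≢true⇒≡false λ uv → no-edge (u , v , x₀u , x₀v , uv))
    where
    open CompleteMultipartite G (λ x y z K₁∪K₂ → none (x , y , z , K₁∪K₂))
    x₀w₀ : adj G x₀ (proj₁ (diameter≤2⇒neighbour diam 2≤n x₀)) ≡ true
    x₀w₀ = proj₂ (diameter≤2⇒neighbour diam 2≤n x₀)

-- Diameter at least three

module _ {n : ℕ} (G : Graph n) where

  -- V ∖ {u₀, u₁, u₂} has only n − 3 elements, yet it is resolving: u₃ lies at distance ≥ 3, 2, 1 from u₀, u₁, u₂.
  module OnGeodesicP4 (P : GeodesicP4 G) (4≤n : 4 ≤ n) where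
    open GeodesicP4 P

    2<n : 2 < n
    2<n = ≤-trans (s≤s (s≤s (s≤s z≤n))) 4≤n

    D : Subset n
    D = ⊤ ∖ u₀ ∖ u₁ ∖ u₂

    size : 3 + ∣ D ∣ ≡ n
    size = ∣⊤∖a∖b∖c∣ (adj⇒≢ G a₀₁) d₀₂ (adj⇒≢ G a₁₂)

    ¬LowerBound : ∀ k → ResolvingDom G k D → LowerBound G k (n ∸ 2) → ⊥
    ¬LowerBound k rd lower = <-irrefl refl (subst (λ m → m ∸ 2 ≤ ∣ D ∣) (sym size) (lower D rd))

    u₃∈D : u₃ ∈ D
    u₃∈D = ∈⊤∖a∖b∖c (d₀₃ ∘ sym) (d₁₃ ∘ sym) (adj⇒≢ G a₂₃ ∘ sym)

    dist₂₃ : dist G u₂ u₃ ≡ just 1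
    dist₂₃ = adj⇒dist≡1 G a₂₃

    dist₁₃ : dist G u₁ u₃ ≡ just 2
    dist₁₃ = dist≡2 G d₁₃ n₁₃ a₁₂ a₂₃ 2<n

    dist₀₃≢1 : dist G u₀ u₃ ≢ just 1
    dist₀₃≢1 e = true≢false (trans (sym (dist≡1⇒adj G e)) n₀₃)

    dist₀₃≢2 : dist G u₀ u₃ ≢ just 2
    dist₀₃≢2 e with reach₂⁻ G (dist⇒reach G e)
    ... | inj₁ u₀≡u₃ = d₀₃ u₀≡u₃
    ... | inj₂ (inj₁ a) = true≢false (trans (sym a) n₀₃)
    ... | inj₂ (inj₂ (c , a , b)) = no-common c a b

    resolving : Resolving G D
    resolving u v u≢v u∉ v∉ = u₃ , u₃∈D , separate (∉⊤∖a∖b∖c u∉) (∉⊤∖a∖b∖c v∉)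
      where
      1≢2 : just 1 ≢ just 2
      1≢2 ()
      separate : u ≡ u₀ ⊎ u ≡ u₁ ⊎ u ≡ u₂ → v ≡ u₀ ⊎ v ≡ u₁ ⊎ v ≡ u₂ → dist G u u₃ ≢ dist G v u₃
      separate (inj₁ refl)        (inj₁ refl)        _ = u≢v refl
      separate (inj₁ refl)        (inj₂ (inj₁ refl)) e = dist₀₃≢2 (trans e dist₁₃)
      separate (inj₁ refl)        (inj₂ (inj₂ refl)) e = dist₀₃≢1 (trans e dist₂₃)
      separate (inj₂ (inj₁ refl)) (inj₁ refl)        e = dist₀₃≢2 (trans (sym e) dist₁₃)
      separate (inj₂ (inj₁ refl)) (inj₂ (inj₁ refl)) _ = u≢v refl
      separate (inj₂ (inj₁ refl)) (inj₂ (inj₂ refl)) e = 1≢2 (trans (sym dist₂₃) (trans (sym e) dist₁₃))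
      separate (inj₂ (inj₂ refl)) (inj₁ refl)        e = dist₀₃≢1 (trans (sym e) dist₂₃)
      separate (inj₂ (inj₂ refl)) (inj₂ (inj₁ refl)) e = 1≢2 (trans (sym dist₂₃) (trans e dist₁₃))
      separate (inj₂ (inj₂ refl)) (inj₂ (inj₂ refl)) _ = u≢v refl

    dominating : ∀ k → 2 ≤ k → (∃ λ d → d ∈ D × ∃ λ m → dist G d u₀ ≡ just m × m ≤ k) → DistDominating G k D
    dominating k 2≤k near-u₀ x x∉ with ∉⊤∖a∖b∖c x∉
    ... | inj₁ refl = near-u₀
    ... | inj₂ (inj₁ refl) = u₃ , u₃∈D , 2 , trans (dist-sym G u₃ u₁) dist₁₃ , 2≤k
    ... | inj₂ (inj₂ refl) = u₃ , u₃∈D , 1 , trans (dist-sym G u₃ u₂) dist₂₃ , ≤-trans (s≤s z≤n) 2≤k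

    ¬LowerBound-3≤k : ∀ k → 3 ≤ k → LowerBound G k (n ∸ 2) → ⊥
    ¬LowerBound-3≤k k 3≤k lower with reach⇒dist≤ G walk 4≤n
      where
      walk : reach (adj G) 3 u₃ u₀ ≡ true
      walk = reach-cons (adj G) 2 (adj-flip G a₂₃) (reach-cons (adj G) 1 (adj-flip G a₁₂) (reach₁ G (adj-flip G a₀₁)))
    ... | m , m≤3 , e =
      ¬LowerBound k (resolving , dominating k (≤-trans (s≤s (s≤s z≤n)) 3≤k) (u₃ , u₃∈D , m , e , ≤-trans m≤3 3≤k)) lower

    module LowerBound₂ (lower : LowerBound G 2 (n ∸ 2)) where

      far-from-u₀ : ∀ d → d ∈ D → ∀ m → dist G d u₀ ≡ just m → m ≤ 2 → ⊥
      far-from-u₀ d d∈ m e m≤2 = ¬LowerBound 2 (resolving , dominating 2 ≤-refl (d , d∈ , m , e , m≤2)) lower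

      u₀-neighbour : ∀ d → adj G u₀ d ≡ true → d ≡ u₁
      u₀-neighbour d a with d ≟ u₁
      ... | yes e = e
      ... | no d≢u₁ = ⊥-elim (far-from-u₀ d d∈ 1 (adj⇒dist≡1 G (adj-flip G a)) (s≤s z≤n))
        where
        d∈ : d ∈ D
        d∈ = ∈⊤∖a∖b∖c (adj⇒≢ G a ∘ sym) d≢u₁ λ { refl → true≢false (trans (sym a) n₀₂) }

      u₁-neighbour : ∀ d → adj G u₁ d ≡ true → d ≡ u₀ ⊎ d ≡ u₂
      u₁-neighbour d a with d ≟ u₀ | d ≟ u₂
      ... | yes e | _ = inj₁ e
      ... | no _ | yes e = inj₂ e
      ... | no d≢u₀ | no d≢u₂ with reach⇒dist≤ G (reach₂ G (adj-flip G a) (adj-flip G a₀₁)) 2<n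
      ...   | m , m≤2 , e = ⊥-elim (far-from-u₀ d (∈⊤∖a∖b∖c d≢u₀ (adj⇒≢ G a ∘ sym) d≢u₂) m e m≤2)

  -- Under the bound, every walk from u₀ stays on u₀u₁u₂u₃, so connectivity makes these all the vertices.
  geodesicP4⇒≅P₄ : Connected G → (P : GeodesicP4 G) → 4 ≤ n → LowerBound G 2 (n ∸ 2) → G ≅ pathG 4
  geodesicP4⇒≅P₄ connected P 4≤n lower =
    inverses⇒≅ G (pathG 4) index (lookup (vertices G P)) index-correct index-lookup adj≡
    where
    open GeodesicP4 P
    module Forward = OnGeodesicP4.LowerBound₂ P 4≤n lower
    module Backward = OnGeodesicP4.LowerBound₂ (reverseP4 G P) 4≤n lower
    OnPath : Fin n → Set
    OnPath v = ∃ λ i → lookup (vertices G P) i ≡ v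
    step : ∀ {c v} → OnPath c → adj G c v ≡ true → OnPath v
    step (zero , refl) a = # 1 , sym (Forward.u₀-neighbour _ a)
    step (suc zero , refl) a = [ (λ e → # 0 , sym e) , (λ e → # 2 , sym e) ]′ (Forward.u₁-neighbour _ a)
    step (suc (suc zero) , refl) a = [ (λ e → # 3 , sym e) , (λ e → # 1 , sym e) ]′ (Backward.u₁-neighbour _ a)
    step (suc (suc (suc zero)) , refl) a = # 2 , sym (Backward.u₀-neighbour _ a)
    walk : ∀ m {v} → reach (adj G) m u₀ v ≡ true → OnPath v
    walk zero r = zero , reach₀⇒≡ (adj G) r
    walk (suc m) r with reach-suc⁻ (adj G) m r
    ... | inj₁ r′ = walk m r′
    ... | inj₂ (c , rc , a) = step (walk m rc) a
    on-path : ∀ v → OnPath v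
    on-path v = walk (proj₁ (connected u₀ v)) (dist⇒reach G (proj₂ (connected u₀ v)))
    index : Fin n → Fin 4
    index v = proj₁ (on-path v)
    index-correct : ∀ v → lookup (vertices G P) (index v) ≡ v
    index-correct v = proj₂ (on-path v)
    index-lookup : ∀ i → index (lookup (vertices G P) i) ≡ i
    index-lookup i = lookup-injective (vertices-unique G P) _ _ (index-correct (lookup (vertices G P) i))
    adj≡ : ∀ u v → adj G u v ≡ pathG 4 (index u) (index v)
    adj≡ u v = trans (cong₂ (adj G) (sym (index-correct u)) (sym (index-correct v))) (vertices-induce-P₄ G P (index u) (index v))

module _ {n : ℕ} (G : Graph n) where

  complete⊎nonadjacent : Complete G ⊎ ∃₂ λ u v → u ≢ v × adj G u v ≡ false
  complete⊎nonadjacent with any? (λ u → any? (λ v → ¬? (u ≟ v) ×-dec (adj G u v ≟ᵇ false)))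
  ... | yes (u , v , u≢v , uv) = inj₂ (u , v , u≢v , uv)
  ... | no none = inj₁ λ u v u≢v → ≢false⇒≡true λ uv → none (u , v , u≢v , uv)

  diameter≤2⊎far-pair : Diameter≤2 (adj G) ⊎ ∃₂ λ u v → reach (adj G) 2 u v ≢ true
  diameter≤2⊎far-pair with any? (λ u → any? (λ v → ¬? (u ≟ v) ×-dec (adj G u v ≟ᵇ false) ×-dec
                                                   ¬? (any? (λ c → (adj G u c ≟ᵇ true) ×-dec (adj G c v ≟ᵇ true)))))
  ... | yes (u , v , u≢v , uv , no-common) = inj₂ (u , v , λ r → far (reach₂⁻ G r))
    where
    far : u ≡ v ⊎ adj G u v ≡ true ⊎ (∃ λ c → adj G u c ≡ true × adj G c v ≡ true) → ⊥
    far (inj₁ u≡v) = u≢v u≡v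
    far (inj₂ (inj₁ uv′)) = true≢false (trans (sym uv′) uv)
    far (inj₂ (inj₂ common)) = no-common common
  ... | no near = inj₁ λ u v u≢v uv → common u v u≢v uv
    where
    common : ∀ u v → u ≢ v → adj G u v ≡ false → ∃ λ c → adj G u c ≡ true × adj G c v ≡ true
    common u v u≢v uv with any? (λ c → (adj G u c ≟ᵇ true) ×-dec (adj G c v ≟ᵇ true))
    ... | yes c = c
    ... | no ¬c = ⊥-elim (near (u , v , u≢v , uv , ¬c))

  γ≡n∸2⇒classified : ∀ k → 2 ≤ k → Connected G → 4 ≤ n → GammaR G k (n ∸ 2) →
                     (k ≡ 2 × G ≅ pathG 4) ⊎ ExceptionalFamily G
  γ≡n∸2⇒classified k 2≤k connected 4≤n ((D₀ , (res₀ , _) , size₀) , lower) with diameter≤2⊎far-pair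
  ... | inj₂ (u , v , far) = geodesic k 2≤k lower
    where
    P : GeodesicP4 G
    P = far-pair⇒geodesicP4 G connected u v far
    geodesic : ∀ k → 2 ≤ k → LowerBound G k (n ∸ 2) → (k ≡ 2 × G ≅ pathG 4) ⊎ ExceptionalFamily G
    geodesic 1 (s≤s ()) _
    geodesic 2 _ lower = inj₁ (refl , geodesicP4⇒≅P₄ G connected P 4≤n lower)
    geodesic (suc (suc (suc k))) _ lower = ⊥-elim (OnGeodesicP4.¬LowerBound-3≤k G P 4≤n _ (s≤s (s≤s (s≤s z≤n))) lower)
  ... | inj₁ diam with complete⊎nonadjacent
  ...   | inj₁ is-complete = ⊥-elim (complete⇒¬resolving G is-complete D₀ res₀
                                     (subst (λ d → 2 + d ≤ n) (sym size₀)
                                            (≤-reflexive (m+[n∸m]≡n (≤-trans (s≤s (s≤s z≤n)) 4≤n)))))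
  ...   | inj₂ (x₀ , y₀ , x₀≢y₀ , x₀y₀) =
    inj₂ (classification G (minimal⇒NoSeparatedTriple G diam 4≤n k 2≤k lower) diam (≤-trans (s≤s (s≤s z≤n)) 4≤n)
                         x₀ y₀ x₀≢y₀ x₀y₀)

  exceptional⇒γ≡n∸2 : ∀ k → 2 ≤ k → 4 ≤ n → ExceptionalFamily G → GammaR G k (n ∸ 2)
  exceptional⇒γ≡n∸2 k 2≤k 4≤n (inj₁ (s , t , 1≤s , 1≤t , iso)) =
    NoSeparatedTriple⇒γ≡n∸2 G k 2≤k 4≤n (transfer-Diameter≤2 completeBip-diameter≤2)
          (transfer-NoSeparatedTriple completeBip-NoSeparatedTriple)
          (transfer-nonadjacent (completeBip-nonadjacent (≤-trans 4≤n n≤m)))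
    where
    open ≅-Transfer G (completeBip s t) iso
    open CompleteBipartite s t 1≤s 1≤t
  exceptional⇒γ≡n∸2 k 2≤k 4≤n (inj₂ (inj₁ (s , t , 1≤s , 2≤t , iso))) =
    NoSeparatedTriple⇒γ≡n∸2 G k 2≤k 4≤n (transfer-Diameter≤2 cliqueJoinIndependent-diameter≤2)
          (transfer-NoSeparatedTriple cliqueJoinIndependent-NoSeparatedTriple) (transfer-nonadjacent cliqueJoinIndependent-nonadjacent)
    where
    open ≅-Transfer G (complete s +G emptyG t) iso
    open CliqueJoinIndependent s t 1≤s 2≤t
  exceptional⇒γ≡n∸2 k 2≤k 4≤n (inj₂ (inj₂ (s , t , 1≤s , 1≤t , iso))) =
    NoSeparatedTriple⇒γ≡n∸2 G k 2≤k 4≤n (transfer-Diameter≤2 cliqueJoinK₁∪Clique-diameter≤2)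
          (transfer-NoSeparatedTriple cliqueJoinK₁∪Clique-NoSeparatedTriple) (transfer-nonadjacent cliqueJoinK₁∪Clique-nonadjacent)
    where
    open ≅-Transfer G (complete s +G (complete 1 ∪G complete t)) iso
    open CliqueJoinK₁∪Clique s t 1≤s 1≤t

  -- A single landmark would make G a path of order at most k + 1 = 3.
  P₄⇒γ₂≡n∸2 : 4 ≤ n → G ≅ pathG 4 → GammaR G 2 (n ∸ 2)
  P₄⇒γ₂≡n∸2 4≤n iso = (⊤ ∖ f⁻¹ (# 0) ∖ f⁻¹ (# 1) , proj₁ P₃ , cong (_∸ 2) (proj₂ P₃)) , lower
    where
    open ≅-Transfer G (pathG 4) iso
    P₃ : ResolvingDom G 2 (⊤ ∖ f⁻¹ (# 0) ∖ f⁻¹ (# 1)) × 2 + ∣ ⊤ ∖ f⁻¹ (# 0) ∖ f⁻¹ (# 1) ∣ ≡ n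
    P₃ = inducedP3⇒resolvingDom G 2 ≤-refl (adj≡⁻¹ (# 0) (# 1)) (adj≡⁻¹ (# 1) (# 2)) (adj≡⁻¹ (# 0) (# 2)) (f⁻¹-≢ λ ())
    n≡4 : n ≡ 4
    n≡4 = ≤-antisym n≤m 4≤n
    lower : LowerBound G 2 (n ∸ 2)
    lower D rd with ∣ D ∣ in size
    ... | zero = ⊥-elim (1≰0 (subst (1 ≤_) size (dominating⇒nonempty G (≤-trans (s≤s z≤n) 4≤n) (proj₂ rd))))
      where
      1≰0 : 1 ≤ 0 → ⊥
      1≰0 ()
    ... | suc zero = ⊥-elim (<-irrefl refl (≤-trans 4≤n (proj₁ (single-landmark⇒path G 2 D rd size))))
    ... | suc (suc d) = subst (λ m → m ∸ 2 ≤ suc (suc d)) (sym n≡4) (s≤s (s≤s z≤n))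

  γ≡1⇔path : ∀ k → 1 ≤ k → 2 ≤ n → GammaR G k 1 ⇔ (∃ λ m → 2 ≤ m × m ≤ k + 1 × G ≅ pathG m)
  γ≡1⇔path k 1≤k 2≤n = mk⇔
    (λ { ((D , rd , size) , _) → n , 2≤n , single-landmark⇒path G k D rd size })
    (λ { (m , 2≤m , m≤k+1 , iso) → let open OnPath G iso (≤-trans (s≤s z≤n) 2≤m) in
         (⁅ endpoint ⁆ , endpoint-resolvingDom k m≤k+1 , ∣⁅x⁆∣≡1 endpoint) ,
         λ D rd → dominating⇒nonempty G (≤-trans (s≤s z≤n) 2≤n) (proj₂ rd) })

  γ≡n∸1⇔complete : Connected G → 2 ≤ n → ∀ k → 2 ≤ k → GammaR G k (n ∸ 1) ⇔ G ≅ complete n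
  γ≡n∸1⇔complete connected 2≤n k 2≤k = mk⇔ forward backward
    where
    forward : GammaR G k (n ∸ 1) → G ≅ complete n
    forward (_ , lower) with complete⊎nonadjacent
    ... | inj₁ is-complete = inverses⇒≅ G (complete n) id id (λ _ → refl) (λ _ → refl) adj≡
      where
      adj≡ : ∀ u v → adj G u v ≡ complete n u v
      adj≡ u v with u ≟ v
      ... | yes refl = irrefl G u
      ... | no u≢v = is-complete u v u≢v
    ... | inj₂ (a , b , a≢b , ab) with nonadjacent⇒inducedP3 G connected a b a≢b ab
    ...   | u , w , v , uw , wv , uv , u≢v with inducedP3⇒resolvingDom G k 2≤k uw wv uv u≢v
    ...     | rd , size = ⊥-elim (<-irrefl refl (subst (λ m → m ∸ 1 ≤ ∣ ⊤ ∖ u ∖ w ∣) (sym size) (lower _ rd)))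
    backward : G ≅ complete n → GammaR G k (n ∸ 1)
    backward iso = (⊤ ∖ u₀ , (resolving , dominating) , cong (_∸ 1) (∣⊤∖a∣ u₀)) , lower
      where
      open ≅-Transfer G (complete n) iso
      complete-G : Complete G
      complete-G u v u≢v = trans (adj≡ u v) (complete-≢ (f-≢ u≢v))
      u₀ : Fin n
      u₀ = fromℕ< (≤-trans (s≤s z≤n) 2≤n)
      resolving : Resolving G (⊤ ∖ u₀)
      resolving u v u≢v u∉ v∉ = ⊥-elim (u≢v (trans (∉⊤∖a u∉) (sym (∉⊤∖a v∉))))
      dominating : DistDominating G k (⊤ ∖ u₀)
      dominating v v∉ with ∉⊤∖a v∉ | another 2≤n u₀
      ... | refl | d , u₀≢d =
        d , ∈⊤∖a (u₀≢d ∘ sym) , 1 , adj⇒dist≡1 G (complete-G d u₀ (u₀≢d ∘ sym)) , ≤-trans (s≤s z≤n) 2≤k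
      lower : LowerBound G k (n ∸ 1)
      lower D (res , _) with n ∸ 1 ≤? ∣ D ∣
      ... | yes le = le
      ... | no ≰ = ⊥-elim (complete⇒¬resolving G complete-G D res (2+ (≰⇒> ≰)))
        where
        2+ : ∀ {d n} → d < n ∸ 1 → 2 + d ≤ n
        2+ {n = suc n} d<n∸1 = s≤s d<n∸1

theorem3p2 : ∀ (n : ℕ) (G : Graph n) → 2 ≤ n →
    (∀ k → 1 ≤ k →
      GammaR G k 1 ⇔ (∃ λ m → 2 ≤ m × m ≤ k + 1 × G ≅ pathG m))
  × (Connected G → 4 ≤ n →
      (GammaR G 2 (n ∸ 2) ⇔
        (G ≅ pathG 4
        ⊎ (∃₂ λ s t → 1 ≤ s × 1 ≤ t × G ≅ completeBip s t)
        ⊎ (∃₂ λ s t → 1 ≤ s × 2 ≤ t × G ≅ (complete s +G emptyG t))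
        ⊎ (∃₂ λ s t → 1 ≤ s × 1 ≤ t × G ≅ (complete s +G (complete 1 ∪G complete t)))))
      × (∀ k → 3 ≤ k →
        GammaR G k (n ∸ 2) ⇔
          ((∃₂ λ s t → 1 ≤ s × 1 ≤ t × G ≅ completeBip s t)
          ⊎ (∃₂ λ s t → 1 ≤ s × 2 ≤ t × G ≅ (complete s +G emptyG t))
          ⊎ (∃₂ λ s t → 1 ≤ s × 1 ≤ t × G ≅ (complete s +G (complete 1 ∪G complete t))))))
  × (Connected G → ∀ k → 2 ≤ k → GammaR G k (n ∸ 1) ⇔ G ≅ complete n)
theorem3p2 n G 2≤n = part-a , part-b , part-c
  where
  part-a : ∀ k → 1 ≤ k → GammaR G k 1 ⇔ (∃ λ m → 2 ≤ m × m ≤ k + 1 × G ≅ pathG m)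
  part-a k 1≤k = γ≡1⇔path G k 1≤k 2≤n

  part-b : Connected G → 4 ≤ n → (GammaR G 2 (n ∸ 2) ⇔ (G ≅ pathG 4 ⊎ ExceptionalFamily G)) ×
                                 (∀ k → 3 ≤ k → GammaR G k (n ∸ 2) ⇔ ExceptionalFamily G)
  part-b connected 4≤n =
    mk⇔ (map₁ proj₂ ∘ classify 2 ≤-refl) [ P₄⇒γ₂≡n∸2 G 4≤n , exceptional⇒γ≡n∸2 G 2 ≤-refl 4≤n ]′ ,
    λ k 3≤k → mk⇔ (drop-P₄ 3≤k ∘ classify k (3≤⇒2≤ 3≤k)) (exceptional⇒γ≡n∸2 G k (3≤⇒2≤ 3≤k) 4≤n)
    where
    classify : ∀ k → 2 ≤ k → GammaR G k (n ∸ 2) → (k ≡ 2 × G ≅ pathG 4) ⊎ ExceptionalFamily G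
    classify k 2≤k = γ≡n∸2⇒classified G k 2≤k connected 4≤n
    3≤⇒2≤ : ∀ {k} → 3 ≤ k → 2 ≤ k
    3≤⇒2≤ = ≤-trans (s≤s (s≤s z≤n))
    drop-P₄ : ∀ {k} → 3 ≤ k → (k ≡ 2 × G ≅ pathG 4) ⊎ ExceptionalFamily G → ExceptionalFamily G
    drop-P₄ (s≤s (s≤s ())) (inj₁ (refl , _))
    drop-P₄ _ (inj₂ family) = family

  part-c : Connected G → ∀ k → 2 ≤ k → GammaR G k (n ∸ 1) ⇔ G ≅ complete n
  part-c connected k 2≤k = γ≡n∸1⇔complete G connected 2≤n k 2≤k
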